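{- For all integers $n>r\geq 1$, \[ T_{n}^{(r)}(x,y)=\sum_{s=1}^{n-r}\binom{n-r}{s}\,[r]_{y}^{\,s}\,y^{\binom{s}{2}}\,T_{n-r}^{(s)}(x,y)+(x-1)\,T_{n-r}^{(1)}(x,y), \] where $[r]_{y}=1+y+y^{2}+\cdots+y^{r-1}$.
   Context: For a finite (multi)graph $G$, its Tutte polynomial is $T_G(x,y)=\sum_{H}(x-1)^{c(H)-1}(y-1)^{e(H)+c(H)-v(H)}$, the sum running over all spanning subgraphs $H$ of $G$ (same vertex set, any subset of the edges), where $c(H)$, $e(H)$, $v(H)$ denote the numbers of connected components, edges and vertices of $H$. For integers $n\geq r\geq 1$, let $K_{n/r}$ denote the multigraph obtained from the complete graph $K_n$ on vertex set $\{1,\dots,n\}$ by contracting all edges between the vertices of an $r$-element subset $R$ into a single vertex $0_R$, without loops: concretely, $K_{n/r}$ has vertex set $\{0_R\}\cup\overline{R}$ with $|\overline{R}|=n-r$, every pair of distinct vertices of $\overline{R}$ is joined by exactly one edge, and $0_R$ is joined to each vertex $w\in\overline{R}$ by $r$ parallel edges (one for each $u\in R$, coming from the edge $uw$ of $K_n$). In particular $K_{n/1}=K_n$ and $K_{n/n}$ is a single vertex with no edges. Define $T_{n}^{(r)}(x,y)=T_{K_{n/r}}(x,y)$; thus $T_n^{(1)}$ is the Tutte polynomial of $K_n$ and $T_n^{(n)}=1$. -}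

module Defs where

open import Level using (Level)
open import Data.Nat using (ℕ; zero; suc; _∸_) renaming (_+_ to _+ℕ_)
open import Data.Nat.Combinatorics using (_C_)
open import Data.Bool using (Bool; true; false; _∧_; _∨_; not; if_then_else_)
open import Data.Fin using (Fin; zero; suc; toℕ; _≟_)
open import Data.Fin using (_<?_)
open import Data.List using (List; []; _∷_; map; foldr; length; replicate; concatMap; filter; allFin; upTo)
open import Data.Bool.ListAction using (any)
open import Data.Product using (_×_; _,_)
open import Relation.Nullary.Decidable using (⌊_⌋)
open import Algebra.Bundles using (CommutativeRing)

-- Finite multigraphs on vertex set Fin m, given by a list of edges.
-- Parallel edges are distinct list entries.

Edges : ℕ → Set
Edges m = List (Fin m × Fin m)

-- all spanning subgraphs = all sub-multisets of the edge list
-- (each list position independently kept or dropped: 2^e of them)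
subgraphs : ∀ {A : Set} → List A → List (List A)
subgraphs [] = [] ∷ []
subgraphs (e ∷ es) = let ss = subgraphs es in map (e ∷_) ss Data.List.++ ss

adjacent : ∀ {m} → Edges m → Fin m → Fin m → Bool
adjacent es u v = any (λ { (a , b) → (⌊ a ≟ u ⌋ ∧ ⌊ b ≟ v ⌋) ∨ (⌊ a ≟ v ⌋ ∧ ⌊ b ≟ u ⌋) }) es

reach : ∀ {m} → Edges m → ℕ → Fin m → Fin m → Bool
reach es zero u v = ⌊ u ≟ v ⌋
reach {m} es (suc k) u v = reach es k u v ∨ any (λ w → reach es k u w ∧ adjacent es w v) (allFin m)

-- connected (walk of length ≤ m suffices on m vertices)
connected : ∀ {m} → Edges m → Fin m → Fin m → Bool
connected {m} es = reach es m

-- number of connected components = number of vertices that are the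
-- least vertex of their component
components : ∀ {m} → Edges m → ℕ
components {m} es =
  length (filter (λ v → not (any (λ u → ⌊ u <? v ⌋ ∧ connected es u v) (allFin m)) Data.Bool.≟ true) (allFin m))

-- The complete graph with an r-set contracted: K_{n/r}.
-- Vertex set Fin (suc k) with k = n ∸ r; vertex zero is 0_R and
-- vertices suc w (w : Fin k) form R̄.

contractedEdges : (k r : ℕ) → Edges (suc k)
contractedEdges k r =
  concatMap (λ i → concatMap (λ j → if ⌊ i <? j ⌋ then (suc i , suc j) ∷ [] else []) (allFin k)) (allFin k)
  Data.List.++ concatMap (λ w → replicate r (zero , suc w)) (allFin k)

-- Polynomial-valued quantities, evaluated in an arbitrary commutative
-- ring (taking R = ℤ[x,y] recovers the polynomial identity).

module _ {c ℓ : Level} (R : CommutativeRing c ℓ) where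
  open CommutativeRing R

  infixr 8 _^'_
  _^'_ : Carrier → ℕ → Carrier
  a ^' zero = 1#
  a ^' suc k = a * (a ^' k)

  nat : ℕ → Carrier
  nat zero = 0#
  nat (suc k) = 1# + nat k

  Σ : ∀ {A : Set} → List A → (A → Carrier) → Carrier
  Σ xs f = foldr (λ a acc → f a + acc) 0# xs

  Tutte : (m : ℕ) → Edges m → Carrier → Carrier → Carrier
  Tutte m es x y =
    Σ (subgraphs es) (λ H →
      ((x - 1#) ^' (components H ∸ 1)) * ((y - 1#) ^' ((length H +ℕ components H) ∸ m)))

  -- T_n^{(r)}(x,y) = Tutte polynomial of K_{n/r}  (for n ≥ r)
  Tnr : (n r : ℕ) → Carrier → Carrier → Carrier
  Tnr n r = Tutte (suc (n ∸ r)) (contractedEdges (n ∸ r) r)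

  qint : ℕ → Carrier → Carrier
  qint r y = Σ (upTo r) (λ i → y ^' i)

{-# OPTIONS --safe #-}
-- Write K_{n/r} as the complete graph on R̄ = {1, …, k}, k = n − r, together with r parallel
-- spokes from the hub 0_R to every vertex of R̄. In the subgraph expansion of the Tutte polynomial
-- a class of r parallel spokes contributes either nothing or, like a single spoke, the factor
-- [r]_y = 1 + y + ⋯ + y^(r−1). Fix the set S of vertices still joined to the hub and contract
-- those spokes: S merges into the hub, the (|S| choose 2) edges inside S become loops, each
-- worth a factor y, the edges between S and the rest become |S| parallel spokes, and what remains
-- is K_{k/|S|}. So S contributes [r]_y^|S| y^(|S| choose 2) T_k^(|S|); grouping the sets S by size
-- gives the binomial coefficients, and S = ∅ leaves the hub isolated, contributing (x − 1) T_k^(1).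
--
-- Components are counted through transversals: a list of pairwise disconnected vertices that
-- meets every component has the number of components as its length.
module Submission where

open import Level using (Level; 0ℓ)
open import Function using (_∘_; _⇔_; Equivalence; mk⇔; id)
open import Data.Empty using (⊥-elim)
open import Data.Unit using (tt)
open import Data.Bool using (Bool; true; false; T; not; _∧_; _∨_; if_then_else_)
import Data.Bool as Bool
open import Data.Bool.Properties using (T-∨; T-∧; T-≡)
open import Data.Bool.ListAction using (any)
open import Data.Nat.Combinatorics using (_C_; nC1≡n; nCk+nC[k+1]≡[n+1]C[k+1]; k>n⇒nCk≡0)
open import Data.Nat as ℕ using (ℕ; zero; suc; _∸_; _≤_; _<_; z≤n; s≤s) renaming (_+_ to _+ℕ_)
import Data.Nat.Properties as ℕ
open import Data.Fin as Fin using (Fin; zero; suc; _≟_; _<?_)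
import Data.Fin.Properties as Fin
open import Data.Fin.Induction using (<-wellFounded)
open import Data.Fin.Subset using (Subset; ∣_∣; ∁; _⊂_; inside; outside) renaming (_∈_ to _∈ˢ_)
open import Data.Fin.Subset.Properties using (∣p∣≤n; p⊂q⇒∣p∣<∣q∣; x∈p⇒∣p-x∣<∣p∣; ∣∁p∣≡n∸∣p∣)
open import Data.Vec using (tabulate; []; _∷_)
open import Data.Vec.Properties using (lookup∘tabulate; lookup⇒[]=; []=⇒lookup)
open import Data.List using (List; []; _∷_; map; length; filter; allFin; _++_; upTo; replicate; concatMap)
import Data.List.Properties as List
open import Data.List.Relation.Unary.Any as Any using (Any; here; there)
open import Data.List.Relation.Unary.Any.Properties using (any⁺; any⁻) renaming (map⁺ to Any-map⁺)
open import Data.List.Relation.Unary.All as All using (All; []; _∷_)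
import Data.List.Relation.Unary.All.Properties as All
open import Data.List.Relation.Unary.AllPairs as AllPairs using (AllPairs; []; _∷_)
import Data.List.Relation.Unary.AllPairs.Properties as AllPairs
open import Data.List.Membership.Propositional using (_∈_)
open import Data.List.Membership.Propositional.Properties using (∈-allFin; ∈-filter⁺; ∈-map⁺; ∈-map⁻; ∈-++⁺ˡ; ∈-++⁺ʳ)
open import Data.Product using (_×_; _,_; ∃-syntax)
import Data.Product as Product
open import Data.Sum using (_⊎_; inj₁; inj₂)
open import Relation.Nullary using (¬_; yes; no; contradiction)
open import Relation.Nullary.Decidable using (⌊_⌋; toWitness; fromWitness; ¬?; T?; decidable-stable; isYes≗does; does-⇔)
open import Relation.Unary as U using (Pred)
open import Relation.Binary using (Rel; Setoid; Symmetric; Transitive; Decidable; _⇒_)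
open import Relation.Binary.Construct.Closure.ReflexiveTransitive as Star using (Star; ε; _◅_; _◅◅_; _⋆)
open import Relation.Binary.PropositionalEquality as ≡ using (_≡_; _≢_; refl; cong; cong₂; subst; module ≡-Reasoning)
open import Induction.WellFounded using (WfRec)
import Induction.WellFounded as WF
open import Algebra.Bundles using (CommutativeRing)
import Algebra.Solver.CommutativeMonoid
import Data.List.Relation.Binary.Permutation.Setoid
import Data.List.Relation.Binary.Permutation.Setoid.Properties
open import Data.List.Relation.Binary.Pointwise as Pointwise using (Pointwise; []; _∷_)
open import Defs

not≡true⇔¬T : ∀ {b} → not b ≡ true ⇔ (¬ T b)
not≡true⇔¬T {false} = mk⇔ (λ _ ()) (λ _ → refl)
not≡true⇔¬T {true}  = mk⇔ (λ ()) (λ ¬t → ⊥-elim (¬t tt))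

AllPairs-filter⁺ : ∀ {a p ℓ} {A : Set a} {P : Pred A p} {R : Rel A ℓ} (P? : U.Decidable P) {xs} →
                   AllPairs (λ x y → P x → P y → R x y) xs → AllPairs R (filter P? xs)
AllPairs-filter⁺ {P = P} {R} P? {xs} rs = discharge (AllPairs.filter⁺ P? rs) (All.all-filter P? xs)
  where
  discharge : ∀ {ys} → AllPairs (λ x y → P x → P y → R x y) ys → All P ys → AllPairs R ys
  discharge []       []       = []
  discharge (r ∷ rs) (p ∷ ps) = All.zipWith (λ (f , q) → f p q) (r , ps) ∷ discharge rs ps

module _ {a ℓ} {A : Set a} {_∼_ : Rel A ℓ}
         (∼-sym : Symmetric _∼_) (∼-trans : Transitive _∼_) (_∼?_ : Decidable _∼_) where

  Separated : List A → Set (a Level.⊔ ℓ)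
  Separated = AllPairs (λ x y → ¬ x ∼ y)

  -- Drop from ys everything equivalent to the head of xs: by separation the tail stays covered.
  separated-length-≤ : ∀ {xs ys} → Separated xs →
    (∀ {x} → x ∈ xs → ∃[ y ] (y ∈ ys × x ∼ y)) → length xs ≤ length ys
  separated-length-≤ {[]}     _             _     = z≤n
  separated-length-≤ {x ∷ xs} {ys} (x≁xs ∷ sep) cover with cover (here refl)
  ... | y , y∈ys , x∼y = ℕ.≤-trans (s≤s (separated-length-≤ sep cover′))
                                    (List.filter-notAll P? ys (Any.map (λ { refl x≁y → x≁y x∼y }) y∈ys))
    where
    P? = λ z → ¬? (x ∼? z)
    cover′ : ∀ {z} → z ∈ xs → ∃[ w ] (w ∈ filter P? ys × z ∼ w)
    cover′ z∈xs with cover (there z∈xs)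
    ... | w , w∈ys , z∼w = w , ∈-filter⁺ P? w∈ys (λ x∼w → All.lookup x≁xs z∈xs (∼-trans x∼w (∼-sym z∼w))) , z∼w

  separated-filter : ∀ b {xs} → Separated xs → length xs ≤ suc (length (filter (λ x → ¬? (x ∼? b)) xs))
  separated-filter b {[]}     _            = z≤n
  separated-filter b {x ∷ xs} (x≁xs ∷ sep) with x ∼? b
  ... | no _    = s≤s (separated-filter b sep)
  ... | yes x∼b = s≤s (ℕ.≤-reflexive (cong length (≡.sym (List.filter-all (λ x → ¬? (x ∼? b))
                    (All.map (λ x≁z z∼b → x≁z (∼-trans x∼b (∼-sym z∼b))) x≁xs)))))

allFin-suc : ∀ {k} → allFin (suc k) ≡ zero ∷ map suc (allFin k)
allFin-suc {k} = cong (zero ∷_) (≡.sym (List.map-tabulate id suc))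

map-allFin-suc : ∀ {A : Set} {k} (f : Fin (suc k) → A) → map f (allFin (suc k)) ≡ f zero ∷ map (f ∘ suc) (allFin k)
map-allFin-suc f = cong (f zero ∷_) (≡.trans (List.map-tabulate suc f) (≡.sym (List.map-tabulate id (f ∘ suc))))

concatMap-allFin-suc : ∀ {A : Set} {k} (f : Fin (suc k) → List A) →
                       concatMap f (allFin (suc k)) ≡ f zero ++ concatMap (f ∘ suc) (allFin k)
concatMap-allFin-suc f = cong Data.List.concat (map-allFin-suc f)

map-map : ∀ {A B B′ C : Set} {f : B → C} {g : A → B} {f′ : B′ → C} {g′ : A → B′} →
          (∀ x → f (g x) ≡ f′ (g′ x)) → ∀ xs → map f (map g xs) ≡ map f′ (map g′ xs)
map-map fg≗f′g′ xs = ≡.trans (≡.sym (List.map-∘ xs)) (≡.trans (List.map-cong fg≗f′g′ xs) (List.map-∘ xs))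

concatMap-[] : ∀ {A B : Set} (f : A → B) xs → concatMap (λ x → f x ∷ []) xs ≡ map f xs
concatMap-[] f xs = ≡.trans (≡.sym (List.concatMap-map Data.List.[_] f xs)) (List.concatMap-pure (map f xs))

replicate-+ : ∀ {A : Set} a b (x : A) → replicate (a +ℕ b) x ≡ replicate a x ++ replicate b x
replicate-+ zero    b x = refl
replicate-+ (suc a) b x = cong (x ∷_) (replicate-+ a b x)

subgraphs-map : ∀ {A B : Set} (f : A → B) xs → subgraphs (map f xs) ≡ map (map f) (subgraphs xs)
subgraphs-map f []       = refl
subgraphs-map f (x ∷ xs) = begin
  map (f x ∷_) (subgraphs (map f xs)) ++ subgraphs (map f xs)
    ≡⟨ cong (λ ss → map (f x ∷_) ss ++ ss) (subgraphs-map f xs) ⟩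
  map (f x ∷_) (map (map f) (subgraphs xs)) ++ map (map f) (subgraphs xs)
    ≡⟨ cong (_++ _) (map-map (λ _ → refl) (subgraphs xs)) ⟩
  map (map f) (map (x ∷_) (subgraphs xs)) ++ map (map f) (subgraphs xs)
    ≡⟨ ≡.sym (List.map-++ (map f) (map (x ∷_) (subgraphs xs)) (subgraphs xs)) ⟩
  map (map f) (map (x ∷_) (subgraphs xs) ++ subgraphs xs) ∎
  where open ≡-Reasoning

subsets : ∀ k → List (Subset k)
subsets zero    = [] ∷ []
subsets (suc k) = map (inside ∷_) (subsets k) ++ map (outside ∷_) (subsets k)

elements : ∀ {k} → Subset k → List (Fin k)
elements []            = []
elements (inside ∷ S)  = zero ∷ map suc (elements S)
elements (outside ∷ S) = map suc (elements S)

length-elements : ∀ {k} (S : Subset k) → length (elements S) ≡ ∣ S ∣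
length-elements []            = refl
length-elements (inside ∷ S)  = cong suc (≡.trans (List.length-map suc (elements S)) (length-elements S))
length-elements (outside ∷ S) = ≡.trans (List.length-map suc (elements S)) (length-elements S)

subgraphs-allFin : ∀ k → subgraphs (allFin k) ≡ map elements (subsets k)
subgraphs-allFin zero    = refl
subgraphs-allFin (suc k) = begin
  subgraphs (allFin (suc k))
    ≡⟨ cong subgraphs allFin-suc ⟩
  map (zero ∷_) (subgraphs (map suc (allFin k))) ++ subgraphs (map suc (allFin k))
    ≡⟨ cong (λ ss → map (zero ∷_) ss ++ ss) lifted ⟩
  map (zero ∷_) (map (map suc ∘ elements) (subsets k)) ++ map (map suc ∘ elements) (subsets k)
    ≡⟨ cong₂ _++_ (map-map (λ _ → refl) (subsets k)) (List.map-∘ (subsets k)) ⟩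
  map elements (map (inside ∷_) (subsets k)) ++ map elements (map (outside ∷_) (subsets k))
    ≡⟨ ≡.sym (List.map-++ elements (map (inside ∷_) (subsets k)) (map (outside ∷_) (subsets k))) ⟩
  map elements (subsets (suc k)) ∎
  where
  open ≡-Reasoning
  lifted : subgraphs (map suc (allFin k)) ≡ map (map suc ∘ elements) (subsets k)
  lifted = ≡.trans (subgraphs-map suc (allFin k))
             (≡.trans (cong (map (map suc)) (subgraphs-allFin k)) (≡.sym (List.map-∘ (subsets k))))

module Sums {c ℓ : Level} (R : CommutativeRing c ℓ) where
  open CommutativeRing R hiding (zero) renaming (refl to ≈-refl)
  open import Relation.Binary.Reasoning.Setoid setoid
  open import Algebra.Properties.CommutativeSemigroup +-commutativeSemigroup using (interchange)

  private
    ∑ : ∀ {A : Set} → List A → (A → Carrier) → Carrier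
    ∑ = Σ R

    infixr 8 _^_
    _^_ : Carrier → ℕ → Carrier
    _^_ = _^'_ R

  Σ-cong : ∀ {A : Set} (xs : List A) {f g : A → Carrier} → (∀ a → f a ≈ g a) → ∑ xs f ≈ ∑ xs g
  Σ-cong []       f≈g = ≈-refl
  Σ-cong (x ∷ xs) f≈g = +-cong (f≈g x) (Σ-cong xs f≈g)

  Σ-++ : ∀ {A : Set} (xs ys : List A) (f : A → Carrier) → ∑ (xs ++ ys) f ≈ ∑ xs f + ∑ ys f
  Σ-++ []       ys f = sym (+-identityˡ _)
  Σ-++ (x ∷ xs) ys f = trans (+-cong ≈-refl (Σ-++ xs ys f)) (sym (+-assoc _ _ _))

  Σ-map : ∀ {A B : Set} (g : A → B) (xs : List A) (f : B → Carrier) → ∑ (map g xs) f ≡ ∑ xs (f ∘ g)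
  Σ-map g []       f = refl
  Σ-map g (x ∷ xs) f = cong (f (g x) +_) (Σ-map g xs f)

  Σ-+ : ∀ {A : Set} (xs : List A) (f g : A → Carrier) → ∑ xs (λ a → f a + g a) ≈ ∑ xs f + ∑ xs g
  Σ-+ []       f g = sym (+-identityˡ _)
  Σ-+ (x ∷ xs) f g = trans (+-cong ≈-refl (Σ-+ xs f g)) (interchange _ _ _ _)

  Σ-*ˡ : ∀ {A : Set} (k : Carrier) (xs : List A) (f : A → Carrier) → k * ∑ xs f ≈ ∑ xs (λ a → k * f a)
  Σ-*ˡ k []       f = zeroʳ k
  Σ-*ˡ k (x ∷ xs) f = trans (distribˡ k (f x) (∑ xs f)) (+-cong ≈-refl (Σ-*ˡ k xs f))

  Σ-0 : ∀ {A : Set} (xs : List A) {f : A → Carrier} → (∀ a → f a ≈ 0#) → ∑ xs f ≈ 0#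
  Σ-0 []       f≈0 = ≈-refl
  Σ-0 (x ∷ xs) f≈0 = trans (+-cong (f≈0 x) (Σ-0 xs f≈0)) (+-identityˡ 0#)

  Σ-comm : ∀ {A B : Set} (xs : List A) (ys : List B) (F : A → B → Carrier) →
           ∑ xs (λ a → ∑ ys (F a)) ≈ ∑ ys (λ b → ∑ xs (λ a → F a b))
  Σ-comm []       ys F = sym (Σ-0 ys (λ _ → ≈-refl))
  Σ-comm (x ∷ xs) ys F = trans (+-cong ≈-refl (Σ-comm xs ys F)) (sym (Σ-+ ys (F x) _))

  Σ-upTo-∷ʳ : ∀ n (g : ℕ → Carrier) → ∑ (upTo (suc n)) g ≈ ∑ (upTo n) g + g n
  Σ-upTo-∷ʳ n g = begin
    ∑ (upTo (suc n)) g        ≡⟨ cong (λ xs → ∑ xs g) (≡.sym (List.upTo-∷ʳ n)) ⟩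
    ∑ (upTo n ++ n ∷ []) g    ≈⟨ Σ-++ (upTo n) (n ∷ []) g ⟩
    ∑ (upTo n) g + (g n + 0#) ≈⟨ +-cong ≈-refl (+-identityʳ (g n)) ⟩
    ∑ (upTo n) g + g n        ∎

  Σ-upTo-suc : ∀ n (g : ℕ → Carrier) → ∑ (upTo (suc n)) g ≡ g 0 + ∑ (upTo n) (g ∘ suc)
  Σ-upTo-suc n g = cong (g 0 +_) (≡.trans (cong (λ xs → ∑ xs g) (≡.sym (List.map-upTo suc n))) (Σ-map suc (upTo n) g))

  Σ-subgraphs-map : ∀ {A B : Set} (f : A → B) xs (F : List B → Carrier) →
                    ∑ (subgraphs (map f xs)) F ≡ ∑ (subgraphs xs) (F ∘ map f)
  Σ-subgraphs-map f xs F = ≡.trans (cong (λ ss → ∑ ss F) (subgraphs-map f xs)) (Σ-map (map f) (subgraphs xs) F)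

  Σ-subgraphs-∷ : ∀ {A : Set} (e : A) es (F : List A → Carrier) →
                  ∑ (subgraphs (e ∷ es)) F ≈ ∑ (subgraphs es) (F ∘ (e ∷_)) + ∑ (subgraphs es) F
  Σ-subgraphs-∷ e es F = trans (Σ-++ (map (e ∷_) (subgraphs es)) (subgraphs es) F)
                               (+-cong (reflexive (Σ-map (e ∷_) (subgraphs es) F)) ≈-refl)

  Σ-subgraphs-++ : ∀ {A : Set} (xs ys : List A) (F : List A → Carrier) →
    ∑ (subgraphs (xs ++ ys)) F ≈ ∑ (subgraphs xs) (λ X → ∑ (subgraphs ys) (λ Y → F (X ++ Y)))
  Σ-subgraphs-++ []       ys F = sym (+-identityʳ _)
  Σ-subgraphs-++ (x ∷ xs) ys F = begin
    ∑ (subgraphs (x ∷ xs ++ ys)) F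
      ≈⟨ Σ-subgraphs-∷ x (xs ++ ys) F ⟩
    ∑ (subgraphs (xs ++ ys)) (F ∘ (x ∷_)) + ∑ (subgraphs (xs ++ ys)) F
      ≈⟨ +-cong (Σ-subgraphs-++ xs ys (F ∘ (x ∷_))) (Σ-subgraphs-++ xs ys F) ⟩
    ∑ (subgraphs xs) (λ X → ∑ (subgraphs ys) (λ Y → F (x ∷ X ++ Y))) +
    ∑ (subgraphs xs) (λ X → ∑ (subgraphs ys) (λ Y → F (X ++ Y)))
      ≈⟨ sym (Σ-subgraphs-∷ x xs (λ X → ∑ (subgraphs ys) (λ Y → F (X ++ Y)))) ⟩
    ∑ (subgraphs (x ∷ xs)) (λ X → ∑ (subgraphs ys) (λ Y → F (X ++ Y))) ∎

  Σ-subgraphs-replicate : ∀ {A : Set} (e : A) (u : Carrier) {F : List A → Carrier} →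
    (∀ X → F (e ∷ X) + F X ≈ u * F X) → ∀ n → ∑ (subgraphs (replicate n e)) F ≈ u ^ n * F []
  Σ-subgraphs-replicate e u {F} step zero    = trans (+-identityʳ _) (sym (*-identityˡ _))
  Σ-subgraphs-replicate e u {F} step (suc n) = begin
    ∑ (subgraphs (e ∷ replicate n e)) F
      ≈⟨ Σ-subgraphs-∷ e (replicate n e) F ⟩
    ∑ (subgraphs (replicate n e)) (F ∘ (e ∷_)) + ∑ (subgraphs (replicate n e)) F
      ≈⟨ sym (Σ-+ (subgraphs (replicate n e)) (F ∘ (e ∷_)) F) ⟩
    ∑ (subgraphs (replicate n e)) (λ X → F (e ∷ X) + F X)
      ≈⟨ Σ-cong (subgraphs (replicate n e)) step ⟩
    ∑ (subgraphs (replicate n e)) (λ X → u * F X)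
      ≈⟨ sym (Σ-*ˡ u (subgraphs (replicate n e)) F) ⟩
    u * ∑ (subgraphs (replicate n e)) F
      ≈⟨ *-cong ≈-refl (Σ-subgraphs-replicate e u step n) ⟩
    u * (u ^ n * F [])
      ≈⟨ sym (*-assoc _ _ _) ⟩
    u ^ suc n * F [] ∎

  module _ {ℓ′} (S : Setoid 0ℓ ℓ′) where
    open Setoid S using () renaming (Carrier to A; _≈_ to _≃_)
    private module ↭ = Data.List.Relation.Binary.Permutation.Setoid S
    open ↭ using (_↭_)

    ↭-Respecting : (List A → Carrier) → Set (ℓ′ Level.⊔ ℓ)
    ↭-Respecting F = ∀ {X Y} → X ↭ Y → F X ≈ F Y

    private
      Σ-subgraphs-cons : ∀ {x y xs ys} → x ≃ y →
        (∀ G → ↭-Respecting G → ∑ (subgraphs xs) G ≈ ∑ (subgraphs ys) G) →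
        ∀ F → ↭-Respecting F → ∑ (subgraphs (x ∷ xs)) F ≈ ∑ (subgraphs (y ∷ ys)) F
      Σ-subgraphs-cons {x} {y} {xs} {ys} x≃y tail F resp = begin
        ∑ (subgraphs (x ∷ xs)) F
          ≈⟨ Σ-subgraphs-∷ x xs F ⟩
        ∑ (subgraphs xs) (F ∘ (x ∷_)) + ∑ (subgraphs xs) F
          ≈⟨ +-cong (tail (F ∘ (x ∷_)) (resp ∘ ↭.↭-prep x)) (tail F resp) ⟩
        ∑ (subgraphs ys) (F ∘ (x ∷_)) + ∑ (subgraphs ys) F
          ≈⟨ +-cong (Σ-cong (subgraphs ys) (λ _ → resp (↭.prep x≃y ↭.↭-refl))) ≈-refl ⟩
        ∑ (subgraphs ys) (F ∘ (y ∷_)) + ∑ (subgraphs ys) F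
          ≈⟨ sym (Σ-subgraphs-∷ y ys F) ⟩
        ∑ (subgraphs (y ∷ ys)) F ∎

      Σ-subgraphs-∷∷ : ∀ (x y : A) zs (F : List A → Carrier) → ∑ (subgraphs (x ∷ y ∷ zs)) F ≈
        (∑ (subgraphs zs) (F ∘ (λ Z → x ∷ y ∷ Z)) + ∑ (subgraphs zs) (F ∘ (x ∷_))) +
        (∑ (subgraphs zs) (F ∘ (y ∷_)) + ∑ (subgraphs zs) F)
      Σ-subgraphs-∷∷ x y zs F = trans (Σ-subgraphs-∷ x (y ∷ zs) F)
        (+-cong (Σ-subgraphs-∷ y zs (F ∘ (x ∷_))) (Σ-subgraphs-∷ y zs F))

      Σ-subgraphs-≋ : ∀ {xs ys} → Pointwise _≃_ xs ys → ∀ F → ↭-Respecting F →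
                      ∑ (subgraphs xs) F ≈ ∑ (subgraphs ys) F
      Σ-subgraphs-≋ [] F resp = ≈-refl
      Σ-subgraphs-≋ {_ ∷ xs} {_ ∷ ys} (x≃y ∷ xs≋ys) = Σ-subgraphs-cons {xs = xs} {ys} x≃y (Σ-subgraphs-≋ xs≋ys)

    Σ-subgraphs-↭ : ∀ {xs ys} → xs ↭ ys → ∀ F → ↭-Respecting F → ∑ (subgraphs xs) F ≈ ∑ (subgraphs ys) F
    Σ-subgraphs-↭ (↭.refl xs≋ys)     = Σ-subgraphs-≋ xs≋ys
    Σ-subgraphs-↭ {_ ∷ xs} {_ ∷ ys} (↭.prep x≃y p) = Σ-subgraphs-cons {xs = xs} {ys} x≃y (Σ-subgraphs-↭ p)
    Σ-subgraphs-↭ (↭.trans p q) F resp = trans (Σ-subgraphs-↭ p F resp) (Σ-subgraphs-↭ q F resp)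
    Σ-subgraphs-↭ {x ∷ y ∷ xs} {y′ ∷ x′ ∷ ys} (↭.swap x≃x′ y≃y′ p) F resp = begin
      ∑ (subgraphs (x ∷ y ∷ xs)) F
        ≈⟨ Σ-subgraphs-∷∷ x y xs F ⟩
      (∑ (subgraphs xs) (F ∘ (λ Z → x ∷ y ∷ Z)) + ∑ (subgraphs xs) (F ∘ (x ∷_))) +
      (∑ (subgraphs xs) (F ∘ (y ∷_)) + ∑ (subgraphs xs) F)
        ≈⟨ +-cong (+-cong (IH (λ q → resp (↭.↭-prep x (↭.↭-prep y q)))) (IH (resp ∘ ↭.↭-prep x)))
                  (+-cong (IH (resp ∘ ↭.↭-prep y)) (IH resp)) ⟩
      (∑ (subgraphs ys) (F ∘ (λ Z → x ∷ y ∷ Z)) + ∑ (subgraphs ys) (F ∘ (x ∷_))) +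
      (∑ (subgraphs ys) (F ∘ (y ∷_)) + ∑ (subgraphs ys) F)
        ≈⟨ interchange _ _ _ _ ⟩
      (∑ (subgraphs ys) (F ∘ (λ Z → x ∷ y ∷ Z)) + ∑ (subgraphs ys) (F ∘ (y ∷_))) +
      (∑ (subgraphs ys) (F ∘ (x ∷_)) + ∑ (subgraphs ys) F)
        ≈⟨ +-cong (+-cong (Σ-cong (subgraphs ys) (λ _ → resp (↭.swap x≃x′ y≃y′ ↭.↭-refl)))
                          (Σ-cong (subgraphs ys) (λ _ → resp (↭.prep y≃y′ ↭.↭-refl))))
                  (+-cong (Σ-cong (subgraphs ys) (λ _ → resp (↭.prep x≃x′ ↭.↭-refl))) ≈-refl) ⟩
      (∑ (subgraphs ys) (F ∘ (λ Z → y′ ∷ x′ ∷ Z)) + ∑ (subgraphs ys) (F ∘ (y′ ∷_))) +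
      (∑ (subgraphs ys) (F ∘ (x′ ∷_)) + ∑ (subgraphs ys) F)
        ≈⟨ sym (Σ-subgraphs-∷∷ y′ x′ ys F) ⟩
      ∑ (subgraphs (y′ ∷ x′ ∷ ys)) F ∎
      where
      IH : ∀ {G} → ↭-Respecting G → ∑ (subgraphs xs) G ≈ ∑ (subgraphs ys) G
      IH {G} = Σ-subgraphs-↭ p G

  nat-+ : ∀ a b → nat R (a +ℕ b) ≈ nat R a + nat R b
  nat-+ zero    b = sym (+-identityˡ _)
  nat-+ (suc a) b = trans (+-cong ≈-refl (nat-+ a b)) (sym (+-assoc _ _ _))

  -- Any range N > k will do, as k C s vanishes for s > k; this frees the Pascal-rule induction
  -- from trimming the top term.
  Σ-subsets : ∀ k (h : ℕ → Carrier) N → k < N → ∑ (subsets k) (h ∘ ∣_∣) ≈ ∑ (upTo N) (λ s → nat R (k C s) * h s)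
  Σ-subsets zero h (suc N) _ = sym (begin
    ∑ (upTo (suc N)) (λ s → nat R (0 C s) * h s)
      ≡⟨ Σ-upTo-suc N (λ s → nat R (0 C s) * h s) ⟩
    nat R 1 * h 0 + ∑ (upTo N) (λ s → nat R (0 C suc s) * h (suc s))
      ≈⟨ +-cong (trans (*-cong (+-identityʳ 1#) ≈-refl) (*-identityˡ (h 0)))
                (Σ-0 (upTo N) (λ s → trans (*-cong (reflexive (cong (nat R) (0C[1+s]≡0 s))) ≈-refl) (zeroˡ _))) ⟩
    h 0 + 0# ∎)
    where
    0C[1+s]≡0 : ∀ s → 0 C suc s ≡ 0
    0C[1+s]≡0 s = k>n⇒nCk≡0 {n = 0} {k = suc s} (s≤s z≤n)
  Σ-subsets (suc k) h (suc N) (s≤s k<N) = begin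
    ∑ (subsets (suc k)) (h ∘ ∣_∣)
      ≈⟨ Σ-++ (map (inside ∷_) (subsets k)) (map (outside ∷_) (subsets k)) (h ∘ ∣_∣) ⟩
    ∑ (map (inside ∷_) (subsets k)) (h ∘ ∣_∣) + ∑ (map (outside ∷_) (subsets k)) (h ∘ ∣_∣)
      ≡⟨ cong₂ _+_ (Σ-map (inside ∷_) (subsets k) (h ∘ ∣_∣)) (Σ-map (outside ∷_) (subsets k) (h ∘ ∣_∣)) ⟩
    ∑ (subsets k) (h ∘ suc ∘ ∣_∣) + ∑ (subsets k) (h ∘ ∣_∣)
      ≈⟨ +-cong (Σ-subsets k (h ∘ suc) N k<N) (Σ-subsets k h (suc N) (ℕ.m<n⇒m<1+n k<N)) ⟩
    ∑ (upTo N) (λ s → nat R (k C s) * h (suc s)) + ∑ (upTo (suc N)) (λ s → nat R (k C s) * h s)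
      ≡⟨ cong (∑ (upTo N) (λ s → nat R (k C s) * h (suc s)) +_) (Σ-upTo-suc N (λ s → nat R (k C s) * h s)) ⟩
    ∑ (upTo N) (λ s → nat R (k C s) * h (suc s)) + (nat R 1 * h 0 + ∑ (upTo N) (λ s → nat R (k C suc s) * h (suc s)))
      ≈⟨ x∙yz≈y∙xz _ _ _ ⟩
    nat R 1 * h 0 + (∑ (upTo N) (λ s → nat R (k C s) * h (suc s)) + ∑ (upTo N) (λ s → nat R (k C suc s) * h (suc s)))
      ≈⟨ +-cong ≈-refl (sym (Σ-+ (upTo N) _ _)) ⟩
    nat R 1 * h 0 + ∑ (upTo N) (λ s → nat R (k C s) * h (suc s) + nat R (k C suc s) * h (suc s))
      ≈⟨ +-cong ≈-refl (Σ-cong (upTo N) pascal) ⟩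
    nat R 1 * h 0 + ∑ (upTo N) (λ s → nat R (suc k C suc s) * h (suc s))
      ≡⟨ ≡.sym (Σ-upTo-suc N (λ s → nat R (suc k C s) * h s)) ⟩
    ∑ (upTo (suc N)) (λ s → nat R (suc k C s) * h s) ∎
    where
    open import Algebra.Properties.CommutativeSemigroup +-commutativeSemigroup using (x∙yz≈y∙xz)
    pascal : ∀ s → nat R (k C s) * h (suc s) + nat R (k C suc s) * h (suc s) ≈ nat R (suc k C suc s) * h (suc s)
    pascal s = trans (sym (distribʳ _ _ _))
      (*-cong (trans (sym (nat-+ (k C s) (k C suc s))) (reflexive (cong (nat R) (nCk+nC[k+1]≡[n+1]C[k+1] k s)))) ≈-refl)

-- Edges, walks and connectedness

infix 4 _≈ᵉ_

data _≈ᵉ_ {m : ℕ} : Rel (Fin m × Fin m) 0ℓ where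
  same    : ∀ {e} → e ≈ᵉ e
  flipped : ∀ {a b} → (a , b) ≈ᵉ (b , a)

≈ᵉ-sym : ∀ {m} → Symmetric (_≈ᵉ_ {m})
≈ᵉ-sym same    = same
≈ᵉ-sym flipped = flipped

≈ᵉ-trans : ∀ {m} → Transitive (_≈ᵉ_ {m})
≈ᵉ-trans same    q       = q
≈ᵉ-trans flipped same    = flipped
≈ᵉ-trans flipped flipped = same

edgeSetoid : ℕ → Setoid 0ℓ 0ℓ
edgeSetoid m = record
  { Carrier       = Fin m × Fin m
  ; _≈_           = _≈ᵉ_
  ; isEquivalence = record { refl = same ; sym = ≈ᵉ-sym ; trans = ≈ᵉ-trans }
  }

Adjacent : ∀ {m} → Edges m → Rel (Fin m) 0ℓ
Adjacent es u v = Any ((u , v) ≈ᵉ_) es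

Walk : ∀ {m} → Edges m → Rel (Fin m) 0ℓ
Walk es = Star (Adjacent es)

module _ {m : ℕ} where

  joins : Fin m → Fin m → Fin m × Fin m → Bool
  joins u v (a , b) = (⌊ a ≟ u ⌋ ∧ ⌊ b ≟ v ⌋) ∨ (⌊ a ≟ v ⌋ ∧ ⌊ b ≟ u ⌋)

  joins-sound : ∀ {u v} e → T (joins u v e) → (u , v) ≈ᵉ e
  joins-sound {u} {v} (a , b) t with a ≟ u | b ≟ v | a ≟ v | b ≟ u
  ... | yes refl | yes refl | _        | _        = same
  ... | yes _    | no _     | yes refl | yes refl = flipped
  ... | no _     | _        | yes refl | yes refl = flipped
  ... | yes _    | no _     | yes _    | no _     = ⊥-elim t
  ... | yes _    | no _     | no _     | _        = ⊥-elim t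
  ... | no _     | _        | yes _    | no _     = ⊥-elim t
  ... | no _     | _        | no _     | _        = ⊥-elim t

  joins-complete : ∀ {u v} e → (u , v) ≈ᵉ e → T (joins u v e)
  joins-complete {u} {v} _ same with u ≟ u | v ≟ v
  ... | yes _  | yes _  = tt
  ... | no u≢u | _      = contradiction refl u≢u
  ... | yes _  | no v≢v = contradiction refl v≢v
  joins-complete {u} {v} _ flipped with v ≟ v | u ≟ u
  ... | yes _  | yes _  = Equivalence.from T-∨ (inj₂ tt)
  ... | no v≢v | _      = contradiction refl v≢v
  ... | yes _  | no u≢u = contradiction refl u≢u

  adjacent⇔Adjacent : ∀ {es : Edges m} {u v} → T (adjacent es u v) ⇔ Adjacent es u v
  adjacent⇔Adjacent {es} {u} {v} = mk⇔
    (Any.map (λ {e} → joins-sound e) ∘ any⁻ (joins u v) es)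
    (any⁺ (joins u v) ∘ Any.map (λ {e} → joins-complete e))

  Adjacent-sym : ∀ {es : Edges m} → Symmetric (Adjacent es)
  Adjacent-sym = Any.map (≈ᵉ-trans flipped)

  Walk-sym : ∀ {es : Edges m} → Symmetric (Walk es)
  Walk-sym = Star.reverse Adjacent-sym

module _ {m : ℕ} (es : Edges m) where

  reach-suc : ∀ k {u v} → T (reach es k u v) → T (reach es (suc k) u v)
  reach-suc k r = Equivalence.from T-∨ (inj₁ r)

  reach-step : ∀ k {u w v} → T (reach es k u w) → Adjacent es w v → T (reach es (suc k) u v)
  reach-step k {w = w} r a = Equivalence.from T-∨ (inj₂ (any⁺ _
    (Any.map (λ { refl → Equivalence.from T-∧ (r , Equivalence.from adjacent⇔Adjacent a) }) (∈-allFin w))))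

  reach⇒Walk : ∀ k {u v} → T (reach es k u v) → Walk es u v
  reach⇒Walk zero {u} {v} r with toWitness {a? = u ≟ v} r
  ... | refl = ε
  reach⇒Walk (suc k) {u} {v} r with Equivalence.to (T-∨ {reach es k u v}) r
  ... | inj₁ r′ = reach⇒Walk k r′
  ... | inj₂ r′ with Any.satisfied (any⁻ _ (allFin m) r′)
  ...   | w , r″ with Equivalence.to (T-∧ {reach es k u w}) r″
  ...     | r‴ , a = reach⇒Walk k r‴ ◅◅ (Equivalence.to adjacent⇔Adjacent a ◅ ε)

  Walk⇒reach : ∀ {u v} → Walk es u v → ∃[ k ] T (reach es k u v)
  Walk⇒reach = Star.foldl (λ u v → ∃[ k ] T (reach es k u v))
    (λ (k , r) a → suc k , reach-step k r a) (0 , fromWitness refl)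

  reach-+ : ∀ d k {u v} → T (reach es k u v) → T (reach es (d +ℕ k) u v)
  reach-+ zero    k r = r
  reach-+ (suc d) k r = reach-suc (d +ℕ k) (reach-+ d k r)

  module _ (u : Fin m) where

    Stable : ℕ → Set
    Stable k = ∀ v → reach es (suc k) u v ≡ reach es k u v

    stable-suc : ∀ k → Stable k → Stable (suc k)
    stable-suc k S v = cong₂ _∨_ (S v)
      (cong Data.Bool.ListAction.or (List.map-cong (λ w → cong (_∧ adjacent es w v) (S w)) (allFin m)))

    stable-+ : ∀ k → Stable k → ∀ d → Stable (d +ℕ k)
    stable-+ k S zero    = S
    stable-+ k S (suc d) = stable-suc (d +ℕ k) (stable-+ k S d)

    stable⇒reach-+ : ∀ k → Stable k → ∀ d v → reach es (d +ℕ k) u v ≡ reach es k u v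
    stable⇒reach-+ k S zero    v = refl
    stable⇒reach-+ k S (suc d) v = ≡.trans (stable-+ k S d v) (stable⇒reach-+ k S d v)

    reached : ℕ → Subset m
    reached k = tabulate (reach es k u)

    ∈-reached : ∀ {k v} → T (reach es k u v) → v ∈ˢ reached k
    ∈-reached {k} {v} r = lookup⇒[]= v _ (≡.trans (lookup∘tabulate (reach es k u) v) (Equivalence.to T-≡ r))

    ∈-reached⁻ : ∀ {k v} → v ∈ˢ reached k → T (reach es k u v)
    ∈-reached⁻ {k} {v} v∈ = Equivalence.from T-≡ (≡.trans (≡.sym (lookup∘tabulate (reach es k u) v)) ([]=⇒lookup v∈))

    -- Until the reached set stabilises it gains a vertex at every step, so it stabilises by step m.
    stable-or-growing : ∀ k → Stable k ⊎ k < ∣ reached k ∣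
    stable-or-growing zero = inj₂ (ℕ.≤-<-trans z≤n (x∈p⇒∣p-x∣<∣p∣ (∈-reached {0} (fromWitness refl))))
    stable-or-growing (suc k) with stable-or-growing k
    ... | inj₁ S = inj₁ (stable-suc k S)
    ... | inj₂ k<∣Rₖ∣ with Fin.all? (λ v → reach es (suc k) u v Bool.≟ reach es k u v)
    ...   | yes S = inj₁ (stable-suc k S)
    ...   | no ¬S = inj₂ (ℕ.<-≤-trans (s≤s k<∣Rₖ∣) (p⊂q⇒∣p∣<∣q∣ Rₖ⊂Rₖ₊₁))
      where
      changed : ∀ {a b : Bool} → (T a → T b) → a ≢ b → T b × ¬ T a
      changed {false} {false} _ a≢b = contradiction refl a≢b
      changed {false} {true}  _ _   = tt , id
      changed {true}  {false} a⇒b _ = ⊥-elim (a⇒b tt)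
      changed {true}  {true}  _ a≢b = contradiction refl a≢b
      Rₖ⊂Rₖ₊₁ : reached k ⊂ reached (suc k)
      Rₖ⊂Rₖ₊₁ with Fin.¬∀⟶∃¬ m _ (λ v → reach es (suc k) u v Bool.≟ reach es k u v) ¬S
      ... | v , ≢ with changed (reach-suc k) (≢ ∘ ≡.sym)
      ...   | r , ¬r = ∈-reached {suc k} ∘ reach-suc k ∘ ∈-reached⁻ {k} ,
                       v , ∈-reached {suc k} r , ¬r ∘ ∈-reached⁻ {k}

    stable-m : Stable m
    stable-m with stable-or-growing m
    ... | inj₁ S     = S
    ... | inj₂ m<∣R∣ = contradiction (∣p∣≤n (reached m)) (ℕ.<⇒≱ m<∣R∣)

    reach⇒connected : ∀ k {v} → T (reach es k u v) → T (connected es u v)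
    reach⇒connected k {v} r with ℕ.≤-total k m
    ... | inj₁ k≤m = subst (λ l → T (reach es l u v)) (ℕ.m∸n+n≡m k≤m) (reach-+ (m ∸ k) k r)
    ... | inj₂ m≤k = subst T (stable⇒reach-+ m stable-m (k ∸ m) v)
                       (subst (λ l → T (reach es l u v)) (≡.sym (ℕ.m∸n+n≡m m≤k)) r)

  connected⇔Walk : ∀ {u v} → T (connected es u v) ⇔ Walk es u v
  connected⇔Walk {u} = mk⇔ (reach⇒Walk m) (λ w → let k , r = Walk⇒reach w in reach⇒connected u k r)

  Walk? : Decidable (Walk es)
  Walk? u v = Relation.Nullary.Decidable.map connected⇔Walk (T? (connected es u v))

-- Components

module _ {m : ℕ} where

  record Transversal (es : Edges m) (L : List (Fin m)) : Set where
    field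
      separated : AllPairs (λ u v → ¬ Walk es u v) L
      covers    : ∀ v → ∃[ u ] (u ∈ L × Walk es u v)

  module _ (es : Edges m) where

    smallerPeer : Fin m → Bool
    smallerPeer v = any (λ u → ⌊ u <? v ⌋ ∧ connected es u v) (allFin m)

    leaders : List (Fin m)
    leaders = filter (λ v → not (smallerPeer v) Bool.≟ true) (allFin m)

    smallerPeer⇔ : ∀ {v} → T (smallerPeer v) ⇔ (∃[ u ] (u Fin.< v × Walk es u v))
    smallerPeer⇔ {v} = mk⇔
      (λ t → let u , t′ = Any.satisfied (any⁻ _ (allFin m) t)
                 u<v , c = Equivalence.to T-∧ t′
             in u , toWitness u<v , Equivalence.to (connected⇔Walk es) c)
      (λ (u , u<v , w) → any⁺ _ (Any.map (λ { refl → Equivalence.from T-∧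
        (fromWitness u<v , Equivalence.from (connected⇔Walk es) w) }) (∈-allFin u)))

    leaders-transversal : Transversal es leaders
    leaders-transversal = record { separated = separated ; covers = WF.All.wfRec <-wellFounded 0ℓ _ covers }
      where
      P? = λ v → not (smallerPeer v) Bool.≟ true

      separated : AllPairs (λ u v → ¬ Walk es u v) leaders
      separated = AllPairs-filter⁺ P? (AllPairs.tabulate⁺-< (λ {u} u<v _ leader w →
        Equivalence.to not≡true⇔¬T leader (Equivalence.from smallerPeer⇔ (u , u<v , w))))

      covers : ∀ v → WfRec Fin._<_ (λ v → ∃[ u ] (u ∈ leaders × Walk es u v)) v →
               ∃[ u ] (u ∈ leaders × Walk es u v)
      covers v rec with P? v
      ... | yes leader = v , ∈-filter⁺ P? (∈-allFin v) leader , ε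
      ... | no ¬leader =
        let w , w<v , w⇝v = Equivalence.to smallerPeer⇔
                              (decidable-stable (T? _) (¬leader ∘ Equivalence.from not≡true⇔¬T))
            u , u∈ , u⇝w = rec w<v
        in u , u∈ , u⇝w ◅◅ w⇝v

  components≡length : ∀ {es L} → Transversal es L → components es ≡ length L
  components≡length {es} {L} t = ℕ.≤-antisym
    (separated-length-≤ Walk-sym Star._◅◅_ (Walk? es) (Transversal.separated (leaders-transversal es))
      (λ {u} _ → let v , v∈ , v⇝u = Transversal.covers t u in v , v∈ , Walk-sym v⇝u))
    (separated-length-≤ Walk-sym Star._◅◅_ (Walk? es) (Transversal.separated t)
      (λ {u} _ → let v , v∈ , v⇝u = Transversal.covers (leaders-transversal es) u in v , v∈ , Walk-sym v⇝u))

  module _ {es fs : Edges m} where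
    open Transversal (leaders-transversal es)

    components-resp : (Adjacent es ⇒ Walk fs) → (Adjacent fs ⇒ Walk es) → components es ≡ components fs
    components-resp es⇒fs fs⇒es = ≡.sym (components≡length (record
      { separated = AllPairs.map (λ ¬w w → ¬w ((fs⇒es ⋆) w)) separated
      ; covers    = λ v → let u , u∈ , w = covers v in u , u∈ , (es⇒fs ⋆) w
      }))

  components-[] : components {m} [] ≡ m
  components-[] = ≡.trans
    (components≡length (record
      { separated = AllPairs.tabulate⁺ (λ u≢v w → u≢v (edgeless w))
      ; covers    = λ v → v , ∈-allFin v , ε
      }))
    (List.length-tabulate id)
    where
    edgeless : ∀ {u v} → Walk [] u v → u ≡ v
    edgeless ε       = refl
    edgeless (() ◅ _)

components-pos : ∀ {m} (es : Edges (suc m)) → 0 < components es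
components-pos {m} es = let _ , u∈ , _ = Transversal.covers (leaders-transversal es) zero in nonempty u∈
  where
  nonempty : ∀ {u} {us : List (Fin (suc m))} → u ∈ us → 0 < length us
  nonempty (here _)  = s≤s z≤n
  nonempty (there _) = s≤s z≤n

mapEdges : ∀ {m n} → (Fin m → Fin n) → Edges m → Edges n
mapEdges φ = map (Product.map φ φ)

module _ {m n : ℕ} (φ : Fin m → Fin n) where

  Adjacent-map⁺ : ∀ {es u v} → Adjacent es u v → Adjacent (mapEdges φ es) (φ u) (φ v)
  Adjacent-map⁺ = Any-map⁺ ∘ Any.map (λ { same → same ; flipped → flipped })

  Adjacent-map⁻ : ∀ es {u′ v′} → Adjacent (mapEdges φ es) u′ v′ →
                  ∃[ u ] ∃[ v ] (φ u ≡ u′ × φ v ≡ v′ × Adjacent es u v)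
  Adjacent-map⁻ ((a , b) ∷ es) (here same)    = a , b , refl , refl , here same
  Adjacent-map⁻ ((a , b) ∷ es) (here flipped) = b , a , refl , refl , here flipped
  Adjacent-map⁻ (_ ∷ es)       (there p)      =
    let u , v , φu , φv , q = Adjacent-map⁻ es p in u , v , φu , φv , there q

  Walk-map : ∀ {es u v} → Walk es u v → Walk (mapEdges φ es) (φ u) (φ v)
  Walk-map = Star.gmap φ Adjacent-map⁺

  module _ {es : Edges m} (fibres-connected : ∀ a b → φ a ≡ φ b → Walk es a b) where

    Walk-unmap : ∀ {u′ v′} → Walk (mapEdges φ es) u′ v′ → ∀ {u v} → φ u ≡ u′ → φ v ≡ v′ → Walk es u v
    Walk-unmap ε       φu φv = fibres-connected _ _ (≡.trans φu (≡.sym φv))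
    Walk-unmap (a ◅ w) φu φv =
      let c , d , φc , φd , c~d = Adjacent-map⁻ es a
      in fibres-connected _ _ (≡.trans φu (≡.sym φc)) ◅◅ c~d ◅ Walk-unmap w φd φv

    separated-map : ∀ {L} → AllPairs (λ u v → ¬ Walk es u v) L →
                    AllPairs (λ u v → ¬ Walk (mapEdges φ es) u v) (map φ L)
    separated-map = AllPairs.map⁺ ∘ AllPairs.map (λ ¬w w → ¬w (Walk-unmap w refl refl))

    components-map : (∀ v → ∃[ u ] (φ u ≡ v)) → components (mapEdges φ es) ≡ components es
    components-map surjective = ≡.trans
      (components≡length (record
        { separated = separated-map separated
        ; covers    = λ v′ → let v , φv = surjective v′ ; u , u∈ , w = covers v
                             in φ u , ∈-map⁺ φ u∈ , subst (Walk _ (φ u)) φv (Walk-map w)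
        }))
      (List.length-map φ (leaders es))
      where open Transversal (leaders-transversal es)

components-lift : ∀ {m} (es : Edges m) → components (mapEdges suc es) ≡ suc (components es)
components-lift {m} es = ≡.trans
  (components≡length (record
    { separated = All.map⁺ (All.tabulate λ {_} _ → zero-isolated) ∷ separated-map suc fibres separated
    ; covers    = λ { zero    → zero , here refl , ε
                    ; (suc v) → let u , u∈ , w = covers v in suc u , there (∈-map⁺ suc u∈) , Walk-map suc w }
    }))
  (cong suc (List.length-map suc (leaders es)))
  where
  open Transversal (leaders-transversal es)
  fibres : ∀ a b → Fin.suc a ≡ suc b → Walk es a b
  fibres a b refl = ε
  zero-isolated : ∀ {v} → ¬ Walk (mapEdges suc es) zero (suc v)
  zero-isolated (a ◅ _) with Adjacent-map⁻ suc es a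
  ... | _ , _ , () , _

module _ {m : ℕ} {Z : Edges m} {a b : Fin m} where

  Walk-∷⁻ : ∀ {u v} → Walk ((a , b) ∷ Z) u v →
            Walk Z u v ⊎ (Walk Z u a × Walk Z b v) ⊎ (Walk Z u b × Walk Z a v)
  Walk-∷⁻ ε = inj₁ ε
  Walk-∷⁻ (there e ◅ w) with Walk-∷⁻ w
  ... | inj₁ p             = inj₁ (e ◅ p)
  ... | inj₂ (inj₁ (p , q)) = inj₂ (inj₁ (e ◅ p , q))
  ... | inj₂ (inj₂ (p , q)) = inj₂ (inj₂ (e ◅ p , q))
  Walk-∷⁻ (here same ◅ w) with Walk-∷⁻ w
  ... | inj₁ p             = inj₂ (inj₁ (ε , p))
  ... | inj₂ (inj₁ (_ , q)) = inj₂ (inj₁ (ε , q))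
  ... | inj₂ (inj₂ (_ , q)) = inj₁ q
  Walk-∷⁻ (here flipped ◅ w) with Walk-∷⁻ w
  ... | inj₁ p             = inj₂ (inj₂ (ε , p))
  ... | inj₂ (inj₁ (_ , q)) = inj₁ q
  ... | inj₂ (inj₂ (_ , q)) = inj₂ (inj₂ (ε , q))

  Walk-∷⁺ : ∀ {u v} → Walk Z u v → Walk ((a , b) ∷ Z) u v
  Walk-∷⁺ = Star.map there

  components-∷-cycle : Walk Z a b → components ((a , b) ∷ Z) ≡ components Z
  components-∷-cycle a⇝b = components-resp bypass (λ e → there e ◅ ε)
    where
    bypass : Adjacent ((a , b) ∷ Z) ⇒ Walk Z
    bypass (here same)    = a⇝b
    bypass (here flipped) = Walk-sym a⇝b
    bypass (there e)      = e ◅ ε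

  components-∷ : components Z ≤ suc (components ((a , b) ∷ Z))
  components-∷ with Walk? Z a b
  ... | yes a⇝b = ℕ.≤-trans (ℕ.≤-reflexive (≡.sym (components-∷-cycle a⇝b))) (ℕ.n≤1+n _)
  ... | no ¬a⇝b = ℕ.≤-trans
    (separated-filter Walk-sym Star._◅◅_ (Walk? Z) b separated)
    (s≤s (ℕ.≤-reflexive (≡.sym (components≡length (record { separated = separated′ ; covers = covers′ })))))
    where
    open Transversal (leaders-transversal Z)
    P? = λ u → ¬? (Walk? Z u b)
    L = filter P? (leaders Z)

    separated′ : AllPairs (λ u v → ¬ Walk ((a , b) ∷ Z) u v) L
    separated′ = AllPairs-filter⁺ P?
      (AllPairs.map (λ ¬u⇝v ¬u⇝b ¬v⇝b → merged ¬u⇝v ¬u⇝b ¬v⇝b ∘ Walk-∷⁻) separated)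
      where
      merged : ∀ {u v} → ¬ Walk Z u v → ¬ Walk Z u b → ¬ Walk Z v b →
               ¬ (Walk Z u v ⊎ (Walk Z u a × Walk Z b v) ⊎ (Walk Z u b × Walk Z a v))
      merged ¬u⇝v _    _    (inj₁ u⇝v)              = ¬u⇝v u⇝v
      merged _    _    ¬v⇝b (inj₂ (inj₁ (_ , b⇝v))) = ¬v⇝b (Walk-sym b⇝v)
      merged _    ¬u⇝b _    (inj₂ (inj₂ (u⇝b , _))) = ¬u⇝b u⇝b

    covers′ : ∀ v → ∃[ u ] (u ∈ L × Walk ((a , b) ∷ Z) u v)
    covers′ v with covers v
    ... | u , u∈ , u⇝v with Walk? Z u b
    ...   | no ¬u⇝b = u , ∈-filter⁺ P? u∈ ¬u⇝b , Walk-∷⁺ u⇝v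
    ...   | yes u⇝b with covers a
    ...     | r , r∈ , r⇝a = r , ∈-filter⁺ P? r∈ (λ r⇝b → ¬a⇝b (Walk-sym r⇝a ◅◅ r⇝b)) ,
                             Walk-∷⁺ r⇝a ◅◅ here same ◅ Walk-∷⁺ (Walk-sym u⇝b ◅◅ u⇝v)

vertices≤edges+components : ∀ {m} (Z : Edges m) → m ≤ length Z +ℕ components Z
vertices≤edges+components []      = ℕ.≤-reflexive (≡.sym components-[])
vertices≤edges+components ((a , b) ∷ Z) = ℕ.≤-trans (vertices≤edges+components Z)
  (ℕ.≤-trans (ℕ.+-monoʳ-≤ (length Z) (components-∷ {Z = Z} {a} {b})) (ℕ.≤-reflexive (ℕ.+-suc (length Z) _)))

module ↭ᵉ {m : ℕ} = Data.List.Relation.Binary.Permutation.Setoid (edgeSetoid m)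
module ↭ᵉ-Properties {m : ℕ} = Data.List.Relation.Binary.Permutation.Setoid.Properties (edgeSetoid m)
module ↭ᶠ {n : ℕ} = Data.List.Relation.Binary.Permutation.Setoid (≡.setoid (Fin n))
module ↭ᶠ-Properties {n : ℕ} = Data.List.Relation.Binary.Permutation.Setoid.Properties (≡.setoid (Fin n))

infix 3 _↭ᵉ_ _↭ᶠ_

_↭ᵉ_ : ∀ {m} → Rel (Edges m) 0ℓ
_↭ᵉ_ = ↭ᵉ._↭_

_↭ᶠ_ : ∀ {n} → Rel (List (Fin n)) 0ℓ
_↭ᶠ_ = ↭ᶠ._↭_

components-resp-↭ : ∀ {m} {X Y : Edges m} → X ↭ᵉ Y → components X ≡ components Y
components-resp-↭ X↭Y = components-resp
  (λ e → ↭ᵉ-Properties.∈-resp-↭ X↭Y e ◅ ε) (λ e → ↭ᵉ-Properties.∈-resp-↭ (↭ᵉ.↭-sym X↭Y) e ◅ ε)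

components-++-loops : ∀ {m} {L : Edges m} → All (λ (a , b) → a ≡ b) L → ∀ Z → components (L ++ Z) ≡ components Z
components-++-loops []                       Z = refl
components-++-loops {L = (a , a) ∷ L} (refl ∷ loops) Z =
  ≡.trans (components-∷-cycle {Z = L ++ Z} ε) (components-++-loops loops Z)

-- The graphs K_{k/r}

spoke : ∀ {k} → Fin k → Fin (suc k) × Fin (suc k)
spoke w = zero , suc w

complete : ∀ k → Edges k
complete zero    = []
complete (suc k) = map spoke (allFin k) ++ mapEdges suc (complete k)

mapEdges-complete-suc : ∀ {k n} (φ : Fin (suc k) → Fin n) →
  mapEdges φ (complete (suc k)) ≡ map (φ zero ,_) (map (φ ∘ suc) (allFin k)) ++ mapEdges (φ ∘ suc) (complete k)
mapEdges-complete-suc {k} φ = ≡.trans (List.map-++ (Product.map φ φ) (map spoke (allFin k)) (mapEdges suc (complete k)))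
  (cong₂ _++_ (map-map (λ _ → refl) (allFin k)) (≡.sym (List.map-∘ (complete k))))

star : ∀ k r → Edges (suc k)
star k r = concatMap (replicate r ∘ spoke) (allFin k)

loops : ∀ {k} → ℕ → Edges (suc k)
loops c = replicate c (zero , zero)

contractedEdges≡ : ∀ k r → contractedEdges k r ≡ mapEdges suc (complete k) ++ star k r
contractedEdges≡ k r = cong (_++ star k r) (orderedPairs≡ k suc)
  where
  orderedPairs : ∀ {M} k → (Fin k → Fin k → Fin M × Fin M) → Edges M
  orderedPairs k h = concatMap (λ i → concatMap (λ j → if ⌊ i <? j ⌋ then h i j ∷ [] else []) (allFin k)) (allFin k)

  <?-suc : ∀ {k} (i j : Fin k) → ⌊ Fin.suc i <? suc j ⌋ ≡ ⌊ i <? j ⌋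
  <?-suc i j = ≡.trans (isYes≗does _)
    (≡.trans (does-⇔ (mk⇔ ℕ.s≤s⁻¹ s≤s) (suc i <? suc j) (i <? j)) (≡.sym (isYes≗does _)))

  orderedPairs-suc : ∀ {M} k (h : Fin (suc k) → Fin (suc k) → Fin M × Fin M) →
    orderedPairs (suc k) h ≡ map (h zero ∘ suc) (allFin k) ++ orderedPairs k (λ i j → h (suc i) (suc j))
  orderedPairs-suc k h = ≡.trans (concatMap-allFin-suc row) (cong₂ _++_ first rest)
    where
    row : Fin (suc k) → Edges _
    row i = concatMap (λ j → if ⌊ i <? j ⌋ then h i j ∷ [] else []) (allFin (suc k))
    first : row zero ≡ map (h zero ∘ suc) (allFin k)
    first = ≡.trans (concatMap-allFin-suc (λ j → if ⌊ Fin.zero {k} <? j ⌋ then h zero j ∷ [] else []))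
                    (concatMap-[] (h zero ∘ suc) (allFin k))
    rest : concatMap (row ∘ suc) (allFin k) ≡ orderedPairs k (λ i j → h (suc i) (suc j))
    rest = List.concatMap-cong (λ i → ≡.trans (concatMap-allFin-suc (λ j → if ⌊ suc i <? j ⌋ then h (suc i) j ∷ [] else []))
             (List.concatMap-cong (λ j → cong (λ b → if b then h (suc i) (suc j) ∷ [] else []) (<?-suc i j)) (allFin k)))
           (allFin k)

  orderedPairs≡ : ∀ {M} k (g : Fin k → Fin M) → orderedPairs k (λ i j → g i , g j) ≡ mapEdges g (complete k)
  orderedPairs≡ zero    g = refl
  orderedPairs≡ (suc k) g = begin
    orderedPairs (suc k) (λ i j → g i , g j)
      ≡⟨ orderedPairs-suc k (λ i j → g i , g j) ⟩
    map (λ j → g zero , g (suc j)) (allFin k) ++ orderedPairs k (λ i j → g (suc i) , g (suc j))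
      ≡⟨ cong₂ _++_ (List.map-∘ (allFin k)) (≡.trans (orderedPairs≡ k (g ∘ suc)) (List.map-∘ (complete k))) ⟩
    mapEdges g (map spoke (allFin k)) ++ mapEdges g (mapEdges suc (complete k))
      ≡⟨ ≡.sym (List.map-++ (Product.map g g) (map spoke (allFin k)) (mapEdges suc (complete k))) ⟩
    mapEdges g (complete (suc k)) ∎
    where open ≡-Reasoning

spokes : ∀ {k} → Subset k → Edges (suc k)
spokes S = map spoke (elements S)

-- Contracting the spokes of S merges S into the hub; the other vertices keep their order.
collapse : ∀ {k} (S : Subset k) → Fin k → Fin (suc ∣ ∁ S ∣)
collapse (inside ∷ S)  zero    = zero
collapse (inside ∷ S)  (suc j) = collapse S j
collapse (outside ∷ S) zero    = suc zero
collapse (outside ∷ S) (suc j) = Fin.punchIn (suc zero) (collapse S j)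

collapse₀ : ∀ {k} (S : Subset k) → Fin (suc k) → Fin (suc ∣ ∁ S ∣)
collapse₀ S zero    = zero
collapse₀ S (suc j) = collapse S j

collapse≡zero⇒∈ : ∀ {k} (S : Subset k) j → collapse S j ≡ zero → j ∈ elements S
collapse≡zero⇒∈ (inside ∷ S)  zero    _ = here refl
collapse≡zero⇒∈ (inside ∷ S)  (suc j) e = there (∈-map⁺ suc (collapse≡zero⇒∈ S j e))
collapse≡zero⇒∈ (outside ∷ S) (suc j) e = ∈-map⁺ suc (collapse≡zero⇒∈ S j (punchIn₁≡zero e))
  where
  punchIn₁≡zero : ∀ {n} {i : Fin (suc n)} → Fin.punchIn (suc zero) i ≡ zero → i ≡ zero
  punchIn₁≡zero {i = zero} _ = refl

∈⇒collapse≡zero : ∀ {k} (S : Subset k) {j} → j ∈ elements S → collapse S j ≡ zero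
∈⇒collapse≡zero (inside ∷ S)  (here refl) = refl
∈⇒collapse≡zero (inside ∷ S)  (there j∈)  with ∈-map⁻ suc j∈
... | _ , j∈S , refl = ∈⇒collapse≡zero S j∈S
∈⇒collapse≡zero (outside ∷ S) j∈          with ∈-map⁻ suc j∈
... | _ , j∈S , refl = cong (Fin.punchIn (suc zero)) (∈⇒collapse≡zero S j∈S)

collapse-injective : ∀ {k} (S : Subset k) i j → collapse S i ≡ collapse S j → i ≡ j ⊎ collapse S i ≡ zero
collapse-injective (inside ∷ S)  zero    zero    _ = inj₁ refl
collapse-injective (inside ∷ S)  zero    (suc j) _ = inj₂ refl
collapse-injective (inside ∷ S)  (suc i) zero    e = inj₂ e
collapse-injective (inside ∷ S)  (suc i) (suc j) e = Data.Sum.map₁ (cong suc) (collapse-injective S i j e)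
collapse-injective (outside ∷ S) zero    zero    _ = inj₁ refl
collapse-injective (outside ∷ S) zero    (suc j) e = contradiction (≡.sym e) (Fin.punchInᵢ≢i (suc zero) (collapse S j))
collapse-injective (outside ∷ S) (suc i) zero    e = contradiction e (Fin.punchInᵢ≢i (suc zero) (collapse S i))
collapse-injective (outside ∷ S) (suc i) (suc j) e with collapse-injective S i j (Fin.punchIn-injective (suc zero) _ _ e)
... | inj₁ refl = inj₁ refl
... | inj₂ c≡0  = inj₂ (cong (Fin.punchIn (suc zero)) c≡0)

collapse-allFin : ∀ {k} (S : Subset k) → map (collapse S) (allFin k) ↭ᶠ replicate ∣ S ∣ zero ++ map suc (allFin ∣ ∁ S ∣)
collapse-allFin []            = ↭ᶠ.↭-refl
collapse-allFin (inside ∷ S)  = ↭ᶠ.↭-trans (↭ᶠ.↭-reflexive (map-allFin-suc _)) (↭ᶠ.↭-prep zero (collapse-allFin S))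
collapse-allFin {suc k} (outside ∷ S) = begin
  map (collapse (outside ∷ S)) (allFin (suc k))
    ≡⟨ ≡.trans (map-allFin-suc _) (cong (one ∷_) (List.map-∘ (allFin k))) ⟩
  one ∷ map shift (map (collapse S) (allFin k))
    ↭⟨ ↭ᶠ.↭-prep one (↭ᶠ-Properties.map⁺ (≡.setoid _) (cong shift) (collapse-allFin S)) ⟩
  one ∷ map shift (replicate s zero ++ map suc (allFin p))
    ≡⟨ cong (one ∷_) (≡.trans (List.map-++ shift (replicate s zero) _)
                              (cong₂ _++_ (List.map-replicate shift s zero) (≡.sym (List.map-∘ (allFin p))))) ⟩
  one ∷ replicate s zero ++ map (Fin.suc ∘ Fin.suc) (allFin p)
    ↭⟨ ↭ᶠ.↭-sym (↭ᶠ-Properties.↭-shift (replicate s zero) _) ⟩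
  replicate s zero ++ one ∷ map (Fin.suc ∘ Fin.suc) (allFin p)
    ≡⟨ cong (replicate s zero ++_) (≡.sym (map-allFin-suc suc)) ⟩
  replicate s zero ++ map suc (allFin (suc p)) ∎
  where
  open ↭ᶠ.PermutationReasoning
  s = ∣ S ∣
  p = ∣ ∁ S ∣
  one : Fin (suc (suc p))
  one = suc zero
  shift : Fin (suc p) → Fin (suc (suc p))
  shift = Fin.punchIn one

collapse₀-surjective : ∀ {k} (S : Subset k) v → ∃[ u ] (collapse₀ S u ≡ v)
collapse₀-surjective S zero    = zero , refl
collapse₀-surjective S (suc i) with ∈-map⁻ (collapse S) (↭ᶠ-Properties.∈-resp-↭ (↭ᶠ.↭-sym (collapse-allFin S))
                                                          (∈-++⁺ʳ (replicate ∣ S ∣ zero) (∈-map⁺ suc (∈-allFin i))))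
... | j , _ , i≡ = suc j , ≡.sym i≡

star-suc : ∀ p s → star p (suc s) ↭ᵉ map spoke (allFin p) ++ star p s
star-suc p s = go (allFin p)
  where
  go : ∀ ws → concatMap (replicate (suc s) ∘ spoke) ws ↭ᵉ map spoke ws ++ concatMap (replicate s ∘ spoke) ws
  go []       = ↭ᵉ.↭-refl
  go (w ∷ ws) = ↭ᵉ.↭-prep (spoke w) (↭ᵉ.↭-trans (↭ᵉ-Properties.++⁺ˡ (replicate s (spoke w)) (go ws))
                                                (↭ᵉ-Properties.shifts (replicate s (spoke w)) (map spoke ws)))

module ++-Solver {m : ℕ} = Algebra.Solver.CommutativeMonoid (↭ᵉ-Properties.++-commutativeMonoid {m})

-- Edges inside S become loops; edges from S to the rest become parallel spokes.
collapse-complete : ∀ {k} (S : Subset k) →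
  mapEdges (collapse S) (complete k) ↭ᵉ loops (∣ S ∣ C 2) ++ (mapEdges suc (complete ∣ ∁ S ∣) ++ star ∣ ∁ S ∣ ∣ S ∣)
collapse-complete [] = ↭ᵉ.↭-refl
collapse-complete {suc k} (inside ∷ S) = begin
  mapEdges (collapse (inside ∷ S)) (complete (suc k))
    ≡⟨ mapEdges-complete-suc (collapse (inside ∷ S)) ⟩
  map (zero ,_) (map (collapse S) (allFin k)) ++ mapEdges (collapse S) (complete k)
    ↭⟨ ↭ᵉ-Properties.++⁺ (↭ᶠ-Properties.map⁺ (edgeSetoid _) (λ { refl → same }) (collapse-allFin S))
                         (collapse-complete S) ⟩
  map (zero ,_) (replicate s zero ++ map suc (allFin p)) ++ (loops c ++ (Kₚ ++ star p s))
    ≡⟨ cong (_++ (loops c ++ (Kₚ ++ star p s))) (≡.trans (List.map-++ (zero ,_) (replicate s zero) _)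
         (cong₂ _++_ (List.map-replicate (zero ,_) s zero) (≡.sym (List.map-∘ (allFin p))))) ⟩
  (loops s ++ map spoke (allFin p)) ++ (loops c ++ (Kₚ ++ star p s))
    ↭⟨ solve 5 (λ A B C D E → ((A ⊕ B) ⊕ (C ⊕ (D ⊕ E))) ⊜ ((A ⊕ C) ⊕ (D ⊕ (B ⊕ E)))) ↭ᵉ.↭-refl
             (loops s) (map spoke (allFin p)) (loops c) Kₚ (star p s) ⟩
  (loops s ++ loops c) ++ (Kₚ ++ (map spoke (allFin p) ++ star p s))
    ≡⟨ cong (_++ (Kₚ ++ (map spoke (allFin p) ++ star p s))) (≡.sym (≡.trans (cong loops (C₂-suc s)) (replicate-+ s c _))) ⟩
  loops (suc s C 2) ++ (Kₚ ++ (map spoke (allFin p) ++ star p s))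
    ↭⟨ ↭ᵉ-Properties.++⁺ˡ (loops (suc s C 2)) (↭ᵉ-Properties.++⁺ˡ Kₚ (↭ᵉ.↭-sym (star-suc p s))) ⟩
  loops (suc s C 2) ++ (Kₚ ++ star p (suc s)) ∎
  where
  open ↭ᵉ.PermutationReasoning
  open ++-Solver {suc ∣ ∁ S ∣} using (solve; _⊜_; _⊕_)
  s = ∣ S ∣
  p = ∣ ∁ S ∣
  c = s C 2
  Kₚ = mapEdges suc (complete p)
  C₂-suc : ∀ s → suc s C 2 ≡ s +ℕ s C 2
  C₂-suc s = ≡.trans (≡.sym (nCk+nC[k+1]≡[n+1]C[k+1] s 1)) (cong (_+ℕ s C 2) (nC1≡n s))
collapse-complete {suc k} (outside ∷ S) = begin
  mapEdges (collapse (outside ∷ S)) (complete (suc k))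
    ≡⟨ ≡.trans (mapEdges-complete-suc (collapse (outside ∷ S)))
               (cong₂ _++_ (map-map (λ _ → refl) (allFin k)) (List.map-∘ (complete k))) ⟩
  map ((one ,_) ∘ shift) (map (collapse S) (allFin k)) ++ mapEdges shift (mapEdges (collapse S) (complete k))
    ↭⟨ ↭ᵉ-Properties.++⁺ (↭ᶠ-Properties.map⁺ (edgeSetoid _) (λ { refl → same }) (collapse-allFin S))
                         (↭ᵉ-Properties.map⁺ (edgeSetoid _) (λ { same → same ; flipped → flipped }) (collapse-complete S)) ⟩
  map ((one ,_) ∘ shift) (replicate s zero ++ map suc (allFin p)) ++ mapEdges shift (loops c ++ (Kₚ ++ star p s))
    ≡⟨ cong₂ _++_ row shifted ⟩
  (replicate s (one , zero) ++ spokes₁) ++ (loops c ++ (mapEdges suc Kₚ ++ star₁))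
    ↭⟨ ↭ᵉ-Properties.++⁺ʳ _ (↭ᵉ-Properties.++⁺ʳ spokes₁
         (↭ᵉ.↭-reflexive-≋ (Pointwise.replicate⁺ flipped s))) ⟩
  (replicate s (zero , one) ++ spokes₁) ++ (loops c ++ (mapEdges suc Kₚ ++ star₁))
    ↭⟨ solve 5 (λ A B C D E → ((A ⊕ B) ⊕ (C ⊕ (D ⊕ E))) ⊜ (C ⊕ ((B ⊕ D) ⊕ (A ⊕ E)))) ↭ᵉ.↭-refl
             (replicate s (zero , one)) spokes₁ (loops c) (mapEdges suc Kₚ) star₁ ⟩
  loops c ++ ((spokes₁ ++ mapEdges suc Kₚ) ++ (replicate s (zero , one) ++ star₁))
    ≡⟨ cong (loops c ++_) (cong₂ _++_
         (≡.sym (≡.trans (mapEdges-complete-suc suc) (cong (spokes₁ ++_) (List.map-∘ (complete p)))))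
         (≡.sym (concatMap-allFin-suc (replicate s ∘ spoke)))) ⟩
  loops c ++ (mapEdges suc (complete (suc p)) ++ star (suc p) s) ∎
  where
  open ↭ᵉ.PermutationReasoning
  open ++-Solver {suc (suc ∣ ∁ S ∣)} using (solve; _⊜_; _⊕_)
  s = ∣ S ∣
  p = ∣ ∁ S ∣
  c = s C 2
  Kₚ = mapEdges suc (complete p)
  one : Fin (suc (suc p))
  one = suc zero
  shift : Fin (suc p) → Fin (suc (suc p))
  shift = Fin.punchIn one
  shiftᵉ = Product.map shift shift
  spokes₁ star₁ : Edges (suc (suc p))
  spokes₁ = map (one ,_) (map (Fin.suc ∘ Fin.suc) (allFin p))
  star₁ = concatMap (replicate s ∘ spoke ∘ suc) (allFin p)

  row : map ((one ,_) ∘ shift) (replicate s zero ++ map suc (allFin p)) ≡ replicate s (one , zero) ++ spokes₁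
  row = ≡.trans (List.map-++ ((one ,_) ∘ shift) (replicate s zero) _)
                (cong₂ _++_ (List.map-replicate ((one ,_) ∘ shift) s zero)
                            (map-map (λ _ → refl) (allFin p)))

  shifted : mapEdges shift (loops c ++ (Kₚ ++ star p s)) ≡ loops c ++ (mapEdges suc Kₚ ++ star₁)
  shifted = ≡.trans (List.map-++ shiftᵉ (loops c) _)
    (cong₂ _++_ (List.map-replicate shiftᵉ c (zero , zero))
      (≡.trans (List.map-++ shiftᵉ Kₚ (star p s))
        (cong₂ _++_ (map-map (λ _ → refl) (complete p))
          (≡.trans (List.map-concatMap shiftᵉ (replicate s ∘ spoke) (allFin p))
                   (List.concatMap-cong (λ w → List.map-replicate shiftᵉ s (spoke w)) (allFin p))))))

components-contract : ∀ {k} (S : Subset k) (A : Edges k) →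
                      components (spokes S ++ mapEdges suc A) ≡ components (mapEdges (collapse S) A)
components-contract S A = begin
  components (spokes S ++ mapEdges suc A)
    ≡⟨ ≡.sym (components-map (collapse₀ S) fibres (collapse₀-surjective S)) ⟩
  components (mapEdges (collapse₀ S) (spokes S ++ mapEdges suc A))
    ≡⟨ cong components (≡.trans (List.map-++ (Product.map (collapse₀ S) (collapse₀ S)) (spokes S) (mapEdges suc A))
                              (cong (mapEdges (collapse₀ S) (spokes S) ++_) (≡.sym (List.map-∘ A)))) ⟩
  components (mapEdges (collapse₀ S) (spokes S) ++ mapEdges (collapse S) A)
    ≡⟨ components-++-loops (All.map⁺ (All.map⁺ (All.tabulate (λ j∈ → ≡.sym (∈⇒collapse≡zero S j∈)))))
                           (mapEdges (collapse S) A) ⟩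
  components (mapEdges (collapse S) A) ∎
  where
  open ≡-Reasoning
  toHub : ∀ {j} → collapse S j ≡ zero → Walk (spokes S ++ mapEdges suc A) zero (suc j)
  toHub c≡0 = Any.map (λ { refl → same }) (∈-++⁺ˡ (∈-map⁺ spoke (collapse≡zero⇒∈ S _ c≡0))) ◅ ε
  fibres : ∀ a b → collapse₀ S a ≡ collapse₀ S b → Walk (spokes S ++ mapEdges suc A) a b
  fibres zero    zero    _ = ε
  fibres zero    (suc j) e = toHub (≡.sym e)
  fibres (suc i) zero    e = Walk-sym (toHub e)
  fibres (suc i) (suc j) e with collapse-injective S i j e
  ... | inj₁ refl = ε
  ... | inj₂ c≡0  = Walk-sym (toHub c≡0) ◅◅ toHub (≡.trans (≡.sym e) c≡0)

-- The Tutte polynomial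

module _ {c ℓ : Level} (R : CommutativeRing c ℓ) (x y : CommutativeRing.Carrier R) where
  open CommutativeRing R hiding (zero) renaming (refl to ≈-refl)
  open import Relation.Binary.Reasoning.Setoid setoid
  open Sums R

  private
    ∑ : ∀ {A : Set} → List A → (A → Carrier) → Carrier
    ∑ = Σ R

    infixr 8 _^_
    _^_ : Carrier → ℕ → Carrier
    _^_ = _^'_ R

  weight : (m : ℕ) → Edges m → Carrier
  weight m H = (x - 1#) ^ (components H ∸ 1) * (y - 1#) ^ ((length H +ℕ components H) ∸ m)

  weight-resp-↭ : ∀ {m} {X Y : Edges m} → X ↭ᵉ Y → weight m X ≡ weight m Y
  weight-resp-↭ {m} X↭Y = cong₂ (λ l c → (x - 1#) ^ (c ∸ 1) * (y - 1#) ^ ((l +ℕ c) ∸ m))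
    (↭ᵉ-Properties.xs↭ys⇒|xs|≡|ys| X↭Y) (components-resp-↭ X↭Y)

  -- An edge closing a cycle raises the nullity by one and leaves the components unchanged.
  weight-cycle : ∀ {m} (Z : Edges m) {a b} → Walk Z a b → weight m ((a , b) ∷ Z) ≈ (y - 1#) * weight m Z
  weight-cycle {m} Z {a} {b} a⇝b = begin
    weight m ((a , b) ∷ Z)
      ≡⟨ cong (λ c → (x - 1#) ^ (c ∸ 1) * (y - 1#) ^ ((suc (length Z) +ℕ c) ∸ m)) (components-∷-cycle a⇝b) ⟩
    (x - 1#) ^ (components Z ∸ 1) * (y - 1#) ^ (suc (length Z +ℕ components Z) ∸ m)
      ≡⟨ cong (λ e → (x - 1#) ^ (components Z ∸ 1) * (y - 1#) ^ e) (ℕ.+-∸-assoc 1 (vertices≤edges+components Z)) ⟩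
    (x - 1#) ^ (components Z ∸ 1) * ((y - 1#) * (y - 1#) ^ ((length Z +ℕ components Z) ∸ m))
      ≈⟨ x∙yz≈y∙xz _ _ _ ⟩
    (y - 1#) * weight m Z ∎
    where open import Algebra.Properties.CommutativeSemigroup *-commutativeSemigroup using (x∙yz≈y∙xz)

  weight-cycle⁺ : ∀ {m} (Z : Edges m) {a b} → Walk Z a b → weight m ((a , b) ∷ Z) + weight m Z ≈ y * weight m Z
  weight-cycle⁺ {m} Z a⇝b = begin
    weight m (_ ∷ Z) + weight m Z                ≈⟨ +-cong (weight-cycle Z a⇝b) (sym (*-identityˡ _)) ⟩
    (y - 1#) * weight m Z + 1# * weight m Z      ≈⟨ sym (distribʳ _ _ _) ⟩
    ((y - 1#) + 1#) * weight m Z                 ≈⟨ *-cong y-1+1≈y ≈-refl ⟩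
    y * weight m Z                               ∎
    where
    y-1+1≈y : (y - 1#) + 1# ≈ y
    y-1+1≈y = trans (+-assoc _ _ _) (trans (+-cong ≈-refl (-‿inverseˡ 1#)) (+-identityʳ y))

  -- A new isolated vertex adds a component and nothing else.
  weight-lift : ∀ {m} (A : Edges (suc m)) → weight (suc (suc m)) (mapEdges suc A) ≈ (x - 1#) * weight (suc m) A
  weight-lift {m} A = begin
    weight (suc (suc m)) (mapEdges suc A)
      ≡⟨ cong₂ (λ l c → (x - 1#) ^ (c ∸ 1) * (y - 1#) ^ ((l +ℕ c) ∸ suc (suc m)))
               (List.length-map _ A) (components-lift A) ⟩
    (x - 1#) ^ components A * (y - 1#) ^ ((length A +ℕ suc (components A)) ∸ suc (suc m))
      ≡⟨ cong₂ _*_ (^-pred (components A) (components-pos A))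
                   (cong (λ e → (y - 1#) ^ (e ∸ suc (suc m))) (ℕ.+-suc (length A) (components A))) ⟩
    (x - 1#) * (x - 1#) ^ (components A ∸ 1) * (y - 1#) ^ ((length A +ℕ components A) ∸ suc m)
      ≈⟨ *-assoc _ _ _ ⟩
    (x - 1#) * weight (suc m) A ∎
    where
    ^-pred : ∀ c → 0 < c → (x - 1#) ^ c ≡ (x - 1#) * (x - 1#) ^ (c ∸ 1)
    ^-pred (suc c) _ = refl

  weight-+ : ∀ {m₁ m} s {X : Edges m₁} {Y : Edges m} → m₁ ≡ s +ℕ m →
             length X ≡ s +ℕ length Y → components X ≡ components Y → weight m₁ X ≡ weight m Y
  weight-+ {m₁} {m} s {X} {Y} refl ∣X∣≡ cX≡cY = cong₂ (λ e c → (x - 1#) ^ (c ∸ 1) * (y - 1#) ^ e)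
    (≡.trans (cong₂ (λ l c → (l +ℕ c) ∸ (s +ℕ m)) ∣X∣≡ cX≡cY)
             (≡.trans (cong (_∸ (s +ℕ m)) (ℕ.+-assoc s (length Y) _)) (ℕ.[m+n]∸[m+o]≡n∸o s _ m)))
    cX≡cY

  weight-contract : ∀ {k} (S : Subset k) (A : Edges k) →
    weight (suc k) (spokes S ++ mapEdges suc A) ≡ weight (suc ∣ ∁ S ∣) (mapEdges (collapse S) A)
  weight-contract {k} S A = weight-+ ∣ S ∣ k+1≡ edges (components-contract S A)
    where
    k+1≡ : suc k ≡ ∣ S ∣ +ℕ suc ∣ ∁ S ∣
    k+1≡ = ≡.sym (≡.trans (ℕ.+-suc ∣ S ∣ ∣ ∁ S ∣)
             (cong suc (≡.trans (cong (∣ S ∣ +ℕ_) (∣∁p∣≡n∸∣p∣ S)) (ℕ.m+[n∸m]≡n (∣p∣≤n S)))))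
    edges : length (spokes S ++ mapEdges suc A) ≡ ∣ S ∣ +ℕ length (mapEdges (collapse S) A)
    edges = ≡.trans (List.length-++ (spokes S))
      (cong₂ _+ℕ_ (≡.trans (List.length-map spoke (elements S)) (length-elements S))
                  (≡.trans (List.length-map _ A) (≡.sym (List.length-map _ A))))

  Σ-loops : ∀ {m} c (A : Edges (suc m)) → ∑ (subgraphs (loops c)) (λ L → weight (suc m) (L ++ A)) ≈ y ^ c * weight (suc m) A
  Σ-loops c A = Σ-subgraphs-replicate (zero , zero) y (λ L → weight-cycle⁺ (L ++ A) ε) c

  Σ-parallel : ∀ {m} (e : Fin m × Fin m) r V →
    ∑ (subgraphs (replicate r e)) (λ X → weight m (X ++ V)) ≈ weight m V + qint R r y * weight m (e ∷ V)
  Σ-parallel e zero    V = +-cong ≈-refl (sym (zeroˡ _))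
  Σ-parallel {m} e (suc r) V = begin
    ∑ (subgraphs (e ∷ replicate r e)) (λ X → weight m (X ++ V))
      ≈⟨ Σ-subgraphs-∷ e (replicate r e) (λ X → weight m (X ++ V)) ⟩
    ∑ (subgraphs (replicate r e)) (λ X → weight m (e ∷ X ++ V)) + ∑ (subgraphs (replicate r e)) (λ X → weight m (X ++ V))
      ≈⟨ +-cong (Σ-subgraphs-replicate e y (λ X → weight-cycle⁺ (e ∷ X ++ V) (here same ◅ ε)) r) (Σ-parallel e r V) ⟩
    y ^ r * weight m (e ∷ V) + (weight m V + qint R r y * weight m (e ∷ V))
      ≈⟨ x∙yz≈y∙xz _ _ _ ⟩
    weight m V + (y ^ r * weight m (e ∷ V) + qint R r y * weight m (e ∷ V))
      ≈⟨ +-cong ≈-refl (trans (sym (distribʳ _ _ _)) (*-cong (trans (+-comm _ _) (sym (Σ-upTo-∷ʳ r (y ^_)))) ≈-refl)) ⟩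
    weight m V + qint R (suc r) y * weight m (e ∷ V) ∎
    where open import Algebra.Properties.CommutativeSemigroup +-commutativeSemigroup using (x∙yz≈y∙xz)

  -- Each class of r parallel edges contributes like a single edge of weight [r]_y.
  Σ-star : ∀ {m} {A : Set} (f : A → Fin m × Fin m) r (L : List A) V →
    ∑ (subgraphs (concatMap (replicate r ∘ f) L)) (λ B → weight m (B ++ V)) ≈
    ∑ (subgraphs (map f L)) (λ Y → qint R r y ^ length Y * weight m (Y ++ V))
  Σ-star f r []      V = +-cong (sym (*-identityˡ _)) ≈-refl
  Σ-star {m} f r (a ∷ L) V = begin
    ∑ (subgraphs (replicate r (f a) ++ rest)) (λ B → weight m (B ++ V))
      ≈⟨ Σ-subgraphs-++ (replicate r (f a)) rest (λ B → weight m (B ++ V)) ⟩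
    ∑ (subgraphs (replicate r (f a))) (λ X → ∑ (subgraphs rest) (λ B → weight m ((X ++ B) ++ V)))
      ≈⟨ Σ-cong (subgraphs (replicate r (f a))) (λ X → Σ-cong (subgraphs rest) (λ B →
           reflexive (cong (weight m) (List.++-assoc X B V)))) ⟩
    ∑ (subgraphs (replicate r (f a))) (λ X → ∑ (subgraphs rest) (λ B → weight m (X ++ B ++ V)))
      ≈⟨ Σ-comm (subgraphs (replicate r (f a))) (subgraphs rest) (λ X B → weight m (X ++ B ++ V)) ⟩
    ∑ (subgraphs rest) (λ B → ∑ (subgraphs (replicate r (f a))) (λ X → weight m (X ++ B ++ V)))
      ≈⟨ Σ-cong (subgraphs rest) (λ B → Σ-parallel (f a) r (B ++ V)) ⟩
    ∑ (subgraphs rest) (λ B → weight m (B ++ V) + q * weight m (f a ∷ B ++ V))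
      ≈⟨ trans (Σ-+ (subgraphs rest) _ _) (+-cong ≈-refl (sym (Σ-*ˡ q (subgraphs rest) _))) ⟩
    ∑ (subgraphs rest) (λ B → weight m (B ++ V)) + q * ∑ (subgraphs rest) (λ B → weight m (f a ∷ B ++ V))
      ≈⟨ +-cong (Σ-star f r L V) (*-cong ≈-refl (trans
           (Σ-cong (subgraphs rest) (λ B → reflexive (weight-resp-↭ (↭ᵉ.↭-sym (↭ᵉ-Properties.↭-shift B V)))))
           (Σ-star f r L (f a ∷ V)))) ⟩
    ∑ (subgraphs (map f L)) (λ Y → q ^ length Y * weight m (Y ++ V)) +
      q * ∑ (subgraphs (map f L)) (λ Y → q ^ length Y * weight m (Y ++ f a ∷ V))
      ≈⟨ +-comm _ _ ⟩
    q * ∑ (subgraphs (map f L)) (λ Y → q ^ length Y * weight m (Y ++ f a ∷ V)) +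
      ∑ (subgraphs (map f L)) (λ Y → q ^ length Y * weight m (Y ++ V))
      ≈⟨ +-cong (trans (Σ-*ˡ q (subgraphs (map f L)) _) (Σ-cong (subgraphs (map f L)) (λ Y →
           trans (sym (*-assoc _ _ _)) (*-cong ≈-refl (reflexive (weight-resp-↭ (↭ᵉ-Properties.↭-shift Y V))))))) ≈-refl ⟩
    ∑ (subgraphs (map f L)) (λ Y → q ^ suc (length Y) * weight m (f a ∷ Y ++ V)) +
      ∑ (subgraphs (map f L)) (λ Y → q ^ length Y * weight m (Y ++ V))
      ≈⟨ sym (Σ-subgraphs-∷ (f a) (map f L) (λ Y → q ^ length Y * weight m (Y ++ V))) ⟩
    ∑ (subgraphs (f a ∷ map f L)) (λ Y → q ^ length Y * weight m (Y ++ V)) ∎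
    where
    rest = concatMap (replicate r ∘ f) L
    q = qint R r y

  Σ-contract : ∀ {k} (S : Subset k) →
    ∑ (subgraphs (mapEdges suc (complete k))) (λ A → weight (suc k) (spokes S ++ A)) ≈
    y ^ (∣ S ∣ C 2) * Tutte R (suc ∣ ∁ S ∣) (contractedEdges ∣ ∁ S ∣ ∣ S ∣) x y
  Σ-contract {k} S = begin
    ∑ (subgraphs (mapEdges suc (complete k))) (λ A → weight (suc k) (spokes S ++ A))
      ≡⟨ Σ-subgraphs-map (Product.map suc suc) (complete k) _ ⟩
    ∑ (subgraphs (complete k)) (λ A → weight (suc k) (spokes S ++ mapEdges suc A))
      ≈⟨ Σ-cong (subgraphs (complete k)) (reflexive ∘ weight-contract S) ⟩
    ∑ (subgraphs (complete k)) (weight (suc p) ∘ mapEdges (collapse S))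
      ≡⟨ ≡.sym (Σ-subgraphs-map (Product.map (collapse S) (collapse S)) (complete k) (weight (suc p))) ⟩
    ∑ (subgraphs (mapEdges (collapse S) (complete k))) (weight (suc p))
      ≈⟨ Σ-subgraphs-↭ (edgeSetoid _) (collapse-complete S) (weight (suc p)) (reflexive ∘ weight-resp-↭) ⟩
    ∑ (subgraphs (loops pairs ++ K)) (weight (suc p))
      ≈⟨ Σ-subgraphs-++ (loops pairs) K (weight (suc p)) ⟩
    ∑ (subgraphs (loops pairs)) (λ L → ∑ (subgraphs K) (λ A → weight (suc p) (L ++ A)))
      ≈⟨ Σ-comm (subgraphs (loops pairs)) (subgraphs K) (λ L A → weight (suc p) (L ++ A)) ⟩
    ∑ (subgraphs K) (λ A → ∑ (subgraphs (loops pairs)) (λ L → weight (suc p) (L ++ A)))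
      ≈⟨ Σ-cong (subgraphs K) (Σ-loops pairs) ⟩
    ∑ (subgraphs K) (λ A → y ^ pairs * weight (suc p) A)
      ≈⟨ sym (Σ-*ˡ (y ^ pairs) (subgraphs K) (weight (suc p))) ⟩
    y ^ pairs * ∑ (subgraphs K) (weight (suc p))
      ≡⟨ cong (λ E → y ^ pairs * ∑ (subgraphs E) (weight (suc p))) (≡.sym (contractedEdges≡ p ∣ S ∣)) ⟩
    y ^ pairs * Tutte R (suc p) (contractedEdges p ∣ S ∣) x y ∎
    where
    p = ∣ ∁ S ∣
    pairs = ∣ S ∣ C 2
    K = mapEdges suc (complete p) ++ star p ∣ S ∣

  -- Contracting the empty set leaves the hub isolated.
  Tnr-zero : ∀ k → Tnr R (suc k) 0 x y ≈ (x - 1#) * Tnr R (suc k) 1 x y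
  Tnr-zero k = begin
    Tutte R (suc (suc k)) (contractedEdges (suc k) 0) x y
      ≡⟨ cong (λ E → ∑ (subgraphs E) (weight (suc (suc k))))
              (≡.trans (contractedEdges≡ (suc k) 0) (≡.trans (cong (mapEdges suc (complete (suc k)) ++_) (star-0 (allFin (suc k))))
                                                            (List.++-identityʳ _))) ⟩
    ∑ (subgraphs (mapEdges suc (complete (suc k)))) (weight (suc (suc k)))
      ≡⟨ Σ-subgraphs-map (Product.map suc suc) (complete (suc k)) (weight (suc (suc k))) ⟩
    ∑ (subgraphs (complete (suc k))) (weight (suc (suc k)) ∘ mapEdges suc)
      ≈⟨ Σ-cong (subgraphs (complete (suc k))) weight-lift ⟩
    ∑ (subgraphs (complete (suc k))) (λ A → (x - 1#) * weight (suc k) A)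
      ≈⟨ sym (Σ-*ˡ (x - 1#) (subgraphs (complete (suc k))) (weight (suc k))) ⟩
    (x - 1#) * ∑ (subgraphs (map spoke (allFin k) ++ mapEdges suc (complete k))) (weight (suc k))
      ≈⟨ *-cong ≈-refl (Σ-subgraphs-↭ (edgeSetoid _) (↭ᵉ-Properties.++-comm (map spoke (allFin k)) _)
                                        (weight (suc k)) (reflexive ∘ weight-resp-↭)) ⟩
    (x - 1#) * ∑ (subgraphs (mapEdges suc (complete k) ++ map spoke (allFin k))) (weight (suc k))
      ≡⟨ cong (λ E → (x - 1#) * ∑ (subgraphs E) (weight (suc k)))
              (≡.sym (≡.trans (contractedEdges≡ k 1) (cong (mapEdges suc (complete k) ++_) star-1))) ⟩
    (x - 1#) * Tutte R (suc k) (contractedEdges k 1) x y ∎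
    where
    star-0 : ∀ ws → concatMap (replicate 0 ∘ spoke {k = suc k}) ws ≡ []
    star-0 []       = refl
    star-0 (_ ∷ ws) = star-0 ws
    star-1 : star k 1 ≡ map spoke (allFin k)
    star-1 = concatMap-[] spoke (allFin k)

  -- Expand each class of r parallel spokes; S records the hub's neighbours that survive.
  Tutte-spokes : ∀ k r → Tutte R (suc k) (contractedEdges k r) x y ≈
    ∑ (subsets k) (λ S → qint R r y ^ ∣ S ∣ *
                         ∑ (subgraphs (mapEdges suc (complete k))) (λ A → weight (suc k) (spokes S ++ A)))
  Tutte-spokes k r = begin
    Tutte R (suc k) (contractedEdges k r) x y
      ≡⟨ cong (λ E → ∑ (subgraphs E) W) (contractedEdges≡ k r) ⟩
    ∑ (subgraphs (K ++ star k r)) W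
      ≈⟨ Σ-subgraphs-++ K (star k r) W ⟩
    ∑ (subgraphs K) (λ A → ∑ (subgraphs (star k r)) (λ B → W (A ++ B)))
      ≈⟨ Σ-cong (subgraphs K) (λ A → Σ-cong (subgraphs (star k r)) (λ B →
           reflexive (weight-resp-↭ (↭ᵉ-Properties.++-comm A B)))) ⟩
    ∑ (subgraphs K) (λ A → ∑ (subgraphs (star k r)) (λ B → W (B ++ A)))
      ≈⟨ Σ-cong (subgraphs K) (Σ-star spoke r (allFin k)) ⟩
    ∑ (subgraphs K) (λ A → ∑ (subgraphs (map spoke (allFin k))) (λ Y → q ^ length Y * W (Y ++ A)))
      ≈⟨ Σ-comm (subgraphs K) (subgraphs (map spoke (allFin k))) (λ A Y → q ^ length Y * W (Y ++ A)) ⟩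
    ∑ (subgraphs (map spoke (allFin k))) (λ Y → ∑ (subgraphs K) (λ A → q ^ length Y * W (Y ++ A)))
      ≈⟨ Σ-cong (subgraphs (map spoke (allFin k))) (λ Y → sym (Σ-*ˡ (q ^ length Y) (subgraphs K) (λ A → W (Y ++ A)))) ⟩
    ∑ (subgraphs (map spoke (allFin k))) (λ Y → q ^ length Y * ∑ (subgraphs K) (λ A → W (Y ++ A)))
      ≡⟨ ≡.trans (Σ-subgraphs-map spoke (allFin k) F)
                 (≡.trans (cong (λ ss → ∑ ss (F ∘ map spoke)) (subgraphs-allFin k))
                          (Σ-map elements (subsets k) (F ∘ map spoke))) ⟩
    ∑ (subsets k) (λ S → q ^ length (spokes S) * ∑ (subgraphs K) (λ A → W (spokes S ++ A)))
      ≈⟨ Σ-cong (subsets k) (λ S → reflexive (cong (λ n → q ^ n * ∑ (subgraphs K) (λ A → W (spokes S ++ A)))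
           (≡.trans (List.length-map spoke (elements S)) (length-elements S)))) ⟩
    ∑ (subsets k) (λ S → q ^ ∣ S ∣ * ∑ (subgraphs K) (λ A → W (spokes S ++ A))) ∎
    where
    W = weight (suc k)
    K = mapEdges suc (complete k)
    q = qint R r y
    F : Edges (suc k) → Carrier
    F Y = q ^ length Y * ∑ (subgraphs K) (λ A → W (Y ++ A))

  Tnr-recursion : ∀ k r → 0 < k → Tutte R (suc k) (contractedEdges k r) x y ≈
    ∑ (map suc (upTo k)) (λ s → nat R (k C s) * (qint R r y ^ s * (y ^ (s C 2) * Tnr R k s x y)))
    + (x - 1#) * Tnr R k 1 x y
  Tnr-recursion (suc k) r _ = begin
    Tutte R (suc (suc k)) (contractedEdges (suc k) r) x y
      ≈⟨ Tutte-spokes (suc k) r ⟩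
    ∑ (subsets (suc k)) (λ S → q ^ ∣ S ∣ *
                               ∑ (subgraphs (mapEdges suc (complete (suc k)))) (λ A → weight (suc (suc k)) (spokes S ++ A)))
      ≈⟨ Σ-cong (subsets (suc k)) (λ S → *-cong ≈-refl (trans (Σ-contract S)
           (reflexive (cong (λ p → y ^ (∣ S ∣ C 2) * Tutte R (suc p) (contractedEdges p ∣ S ∣) x y)
                            (∣∁p∣≡n∸∣p∣ S))))) ⟩
    ∑ (subsets (suc k)) (G ∘ ∣_∣)
      ≈⟨ Σ-subsets (suc k) G (suc (suc k)) ℕ.≤-refl ⟩
    ∑ (upTo (suc (suc k))) (λ s → nat R (suc k C s) * G s)
      ≡⟨ Σ-upTo-suc (suc k) (λ s → nat R (suc k C s) * G s) ⟩
    nat R 1 * G 0 + ∑ (upTo (suc k)) (λ s → nat R (suc k C suc s) * G (suc s))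
      ≈⟨ +-comm _ _ ⟩
    ∑ (upTo (suc k)) (λ s → nat R (suc k C suc s) * G (suc s)) + nat R 1 * G 0
      ≈⟨ +-cong (reflexive (≡.sym (Σ-map suc (upTo (suc k)) (λ s → nat R (suc k C s) * G s)))) empty-term ⟩
    ∑ (map suc (upTo (suc k))) (λ s → nat R (suc k C s) * G s) + (x - 1#) * Tnr R (suc k) 1 x y ∎
    where
    q = qint R r y
    G : ℕ → Carrier
    G s = q ^ s * (y ^ (s C 2) * Tnr R (suc k) s x y)
    empty-term : nat R 1 * G 0 ≈ (x - 1#) * Tnr R (suc k) 1 x y
    empty-term = trans (*-cong (+-identityʳ 1#) ≈-refl)
      (trans (*-identityˡ _) (trans (*-identityˡ _) (trans (*-identityˡ _) (Tnr-zero k))))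

theorem1 : ∀ {c ℓ : Level} (R : CommutativeRing c ℓ) (n r : ℕ) → 1 ≤ r → r < n →
    let open CommutativeRing R in
    (x y : Carrier) →
    Tnr R n r x y ≈
      Σ R (map suc (upTo (n ∸ r))) (λ s →
        nat R ((n ∸ r) C s) * (_^'_ R (qint R r y) s * (_^'_ R y (s C 2) * Tnr R (n ∸ r) s x y)))
      + (x - 1#) * Tnr R (n ∸ r) 1 x y
theorem1 R n r _ r<n x y = Tnr-recursion R x y (n ∸ r) r (ℕ.m<n⇒0<n∸m r<n)
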